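{- Let $k\geq 5$ and $\alpha=\frac{k-2}{2k-7}$. Suppose $T$ is a GDP-tree and $h:V(T)\to\mathbb{N}\cup\{0\}$ satisfies (i) $3\leq h(v)\leq k-1$ for each $v\in V(T)$; (ii) $h(v)\geq d_T(v)$ for each $v\in V(T)$; (iii) $T$ has neither $(k-1)$-regular nor $(k-2)$-regular blocks. Then $$\Phi_k(T):=\alpha\,\sigma_h(T)+m(T)+|V^-_{k-1}(T)|-|V_{k-1}(T)|>1+\alpha.$$
   Context: For a simple graph $F$ and positive integer $t$, $F^t$ is obtained by replacing each edge by $t$ parallel edges. A GDP-tree is a connected loopless multigraph each of whose blocks is isomorphic to $K_n^t$ or $C_n^t$ for some $n,t$. $d_T(v)$ is the degree (counting multiplicity). The skeleton $\widetilde T$ is the simple graph on $V(T)$ with $u\sim v$ iff they are joined by at least one edge; $m(T)=|E(T)|-|E(\widetilde T)|$. $\sigma_h(T)=\sum_{v\in V(T)}(h(v)-d_T(v))$. $V_j(T)$ is the set of $v$ with $h(v)=j$, and $V^-_j(T)$ is the set of $v$ with $h(v)<j$. -}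

module Defs where

open import Data.Nat as N using (ℕ; zero; suc; _≤_; _≡ᵇ_; _<ᵇ_; _∸_)
open import Data.Integer as Z using (ℤ; +_)
open import Data.Rational as Q using (ℚ; 0ℚ)
open import Data.Fin using (Fin; toℕ; _≟_)
open import Data.Bool using (Bool; true; false; if_then_else_; _∧_; _∨_; not)
open import Data.List using (List; []; _∷_)
open import Data.List.Relation.Unary.Any using (Any)
open import Data.Product using (Σ; ∃; _×_)
open import Data.Sum using (_⊎_)
open import Relation.Nullary.Decidable using (⌊_⌋)
open import Relation.Binary.PropositionalEquality using (_≡_)
open import Function.Definitions using (Injective)

sumFin : ∀ {n} → (Fin n → ℕ) → ℕ
sumFin {zero}  f = 0
sumFin {suc n} f = f Fin.zero + sumFin (λ i → f (Fin.suc i))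
  where open N using (_+_)

sumFinℤ : ∀ {n} → (Fin n → ℤ) → ℤ
sumFinℤ {zero}  f = + 0
sumFinℤ {suc n} f = f Fin.zero Z.+ sumFinℤ (λ i → f (Fin.suc i))

countFin : ∀ {n} → (Fin n → Bool) → ℕ
countFin P = sumFin (λ v → if P v then 1 else 0)

-- Block shapes: K_s^t (complete, s ≥ 2) and C_s^t (cycle, s ≥ 3)
data Shape : Set where
  K C : Shape

ValidSize : Shape → ℕ → Set
ValidSize K s = 2 ≤ s
ValidSize C s = 3 ≤ s

-- i ~ j in the cycle 0,1,...,s-1,0 (one direction)
succAdj : (s : ℕ) → Fin s → Fin s → Bool
succAdj s i j = (suc (toℕ i) ≡ᵇ toℕ j) ∨ ((suc (toℕ i) ≡ᵇ s) ∧ (toℕ j ≡ᵇ 0))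

adjShape : Shape → (s : ℕ) → Fin s → Fin s → Bool
adjShape K s i j = not ⌊ i ≟ j ⌋
adjShape C s i j = succAdj s i j ∨ succAdj s j i

-- A block: a copy of F^t (F = K_s or C_s) embedded injectively in vertex set Fin n
record Block (n : ℕ) : Set where
  field
    shape    : Shape
    size     : ℕ
    size-ok  : ValidSize shape size
    vert     : Fin size → Fin n
    vert-inj : Injective _≡_ _≡_ vert
    mul      : ℕ
    mul-pos  : 1 ≤ mul

open Block public

blockMult : ∀ {n} → Block n → Fin n → Fin n → ℕ
blockMult B u v =
  sumFin (λ i → sumFin (λ j →
    if ⌊ vert B i ≟ u ⌋ ∧ ⌊ vert B j ≟ v ⌋ ∧ adjShape (shape B) (size B) i j
    then mul B else 0))

InBlock : ∀ {n} → Block n → Fin n → Set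
InBlock B v = ∃ λ i → vert B i ≡ v

InSome : ∀ {n} → List (Block n) → Fin n → Set
InSome bs v = Any (λ B → InBlock B v) bs

SharesExactlyOne : ∀ {n} → Block n → List (Block n) → Set
SharesExactlyOne B bs =
  Σ _ λ v → (InBlock B v × InSome bs v) × (∀ w → InBlock B w → InSome bs w → w ≡ v)

-- block-tree structure: blocks are added one by one, each glued to the
-- previously built graph at exactly one vertex
data Attached {n : ℕ} : List (Block n) → Set where
  one : (B : Block n) → Attached (B ∷ [])
  add : ∀ {bs} (B : Block n) → Attached bs → SharesExactlyOne B bs → Attached (B ∷ bs)

-- A GDP-tree on vertex set Fin n, given by its (edge-disjoint) block decomposition.
record GDPTree (n : ℕ) : Set where
  field
    blocks    : List (Block n)
    structure : (n ≡ 1 × blocks ≡ [])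
              ⊎ (Attached blocks × (∀ v → InSome blocks v))

open GDPTree public

mult : ∀ {n} → GDPTree n → Fin n → Fin n → ℕ
mult T u v = go (blocks T)
  where
    go : List (Block _) → ℕ
    go []       = 0
    go (B ∷ bs) = blockMult B u v N.+ go bs

deg : ∀ {n} → GDPTree n → Fin n → ℕ
deg T v = sumFin (λ u → mult T v u)

IsRegular : ∀ {n} → Block n → ℕ → Set
IsRegular B d = ∀ i → sumFin (λ u → blockMult B (vert B i) u) ≡ d

sumPairs : ∀ {n} → (Fin n → Fin n → ℕ) → ℕ
sumPairs f = sumFin (λ u → sumFin (λ v → if toℕ u <ᵇ toℕ v then f u v else 0))

numEdges : ∀ {n} → GDPTree n → ℕ
numEdges T = sumPairs (mult T)

numSkelEdges : ∀ {n} → GDPTree n → ℕ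
numSkelEdges T = sumPairs (λ u v → if 1 N.≤ᵇ mult T u v then 1 else 0)

mT : ∀ {n} → GDPTree n → ℤ
mT T = + numEdges T Z.- + numSkelEdges T

sigma : ∀ {n} → GDPTree n → (Fin n → ℕ) → ℤ
sigma T h = sumFinℤ (λ v → + h v Z.- + deg T v)

numV : ∀ {n} → (Fin n → ℕ) → ℕ → ℕ
numV h j = countFin (λ v → h v ≡ᵇ j)

numVminus : ∀ {n} → (Fin n → ℕ) → ℕ → ℕ
numVminus h j = countFin (λ v → h v <ᵇ j)

-- α = (k-2)/(2k-7); only meaningful for k ≥ 5 (junk value 0 otherwise)
alpha : ℕ → ℚ
alpha (suc (suc (suc (suc (suc j))))) = + (3 N.+ j) Q./ (3 N.+ 2 N.* j)
alpha _ = 0ℚ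

Phi : ∀ {n} → ℕ → GDPTree n → (Fin n → ℕ) → ℚ
Phi k T h = alpha k Q.* (sigma T h Q./ 1)
            Q.+ ((mT T Z.+ + numVminus h (k ∸ 1) Z.- + numV h (k ∸ 1)) Q./ 1)

-- Write k = 5 + b, p = k − 2 = 3 + b and q = 2k − 7 = 3 + 2b, so that α = p/q.  Clearing the
-- denominator, the claim becomes the integer inequality p·σ_h(T) + q·M ≥ p + q + 1 with
-- M = m(T) + |V⁻_{k−1}| − |V_{k−1}|.
--
-- Give a vertex of degree d the weight w(d) = q for d = 0, 9 + 4b for d = 1 and
-- min(p(k − 1 − d), 6 + 3b) for d ≥ 2, and build T one block at a time.  A block F^t is
-- D-regular with D = t·c, where c is the degree of F, and D ≤ k − 3 because its degrees are at most
-- k − 1 and it is neither (k−1)- nor (k−2)-regular.  Gluing it on at one vertex costs that vertex at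
-- most D·(w(D) − q), gives each of the other s − 1 ≥ c vertices w(D) − q, and raises m(T) by at
-- least (t − 1)·c; since w(D) − q ≤ q once t ≥ 2, the potential Σ_v w(d_v) + q·m(T) − q·|V| never
-- decreases, and after the first block it is already at least 7 + 3b (a GDP-tree without blocks
-- is a single vertex and is checked directly).  Finally
-- w(d) ≤ p(h − d) + 2q·[h < k − 1] for every admissible h, and summing this over the vertices turns
-- the bound on the potential into the claim.

module Submission where

open import Defs
open import Data.Nat using (ℕ)

module FiniteSums where

  open import Data.Nat as ℕ using (ℕ; zero; suc; _+_; _*_; _≤_; _<_; z≤n; _<ᵇ_; _≡ᵇ_)
  open import Data.Nat.Properties
    using (+-*-semiring; +-commutativeSemigroup; +-identityʳ; *-identityʳ; *-zeroʳ; +-comm; +-assoc; +-mono-≤; +-monoʳ-≤;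
           +-cancelʳ-≤; ≮⇒≥; ≤-antisym; <-asym; <-irrefl; ≤∧≢⇒<; <ᵇ-reflects-<; module ≤-Reasoning)
  open import Algebra.Properties.CommutativeSemigroup +-commutativeSemigroup using (xy∙z≈xz∙y; x∙yz≈xz∙y)
  open import Algebra.Properties.Semiring.Sum +-*-semiring using (sum; ∑-distrib-+; ∑-comm; *-distribˡ-sum)
  open import Data.Fin using (Fin; zero; suc; toℕ; fromℕ<; _≟_)
  open import Data.Fin.Properties using (0≢1+n; suc-injective; toℕ-injective; toℕ-fromℕ<; any?)
  open import Data.Bool using (Bool; true; false; if_then_else_; T; not; _∧_; _∨_)
  open import Data.Empty using (⊥; ⊥-elim)
  open import Data.Product using (_,_)
  open import Function using (_∘_; id; _⇔_; mk⇔; Equivalence)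
  open import Function.Definitions using (Injective)
  open import Relation.Nullary using (¬_; yes; no; ofʸ; ofⁿ; proof)
  open import Relation.Nullary.Decidable using (⌊_⌋; toWitness; fromWitness)
  open import Relation.Binary.PropositionalEquality
  open Equivalence

  sumFin-cong : ∀ {n} {f g : Fin n → ℕ} → (∀ i → f i ≡ g i) → sumFin f ≡ sumFin g
  sumFin-cong {zero}  eq = refl
  sumFin-cong {suc n} eq = cong₂ _+_ (eq zero) (sumFin-cong (eq ∘ suc))

  sumFin-zero : ∀ {n} {f : Fin n → ℕ} → (∀ i → f i ≡ 0) → sumFin f ≡ 0
  sumFin-zero {zero}  eq = refl
  sumFin-zero {suc n} eq = cong₂ _+_ (eq zero) (sumFin-zero (eq ∘ suc))

  sumFin-const : ∀ {n} c → sumFin {n} (λ _ → c) ≡ n * c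
  sumFin-const {zero}  c = refl
  sumFin-const {suc n} c = cong (c +_) (sumFin-const {n} c)

  sumFin-mono : ∀ {n} {f g : Fin n → ℕ} → (∀ i → f i ≤ g i) → sumFin f ≤ sumFin g
  sumFin-mono {zero}  le = z≤n
  sumFin-mono {suc n} le = +-mono-≤ (le zero) (sumFin-mono (le ∘ suc))

  sumFin≡sum : ∀ {n} (f : Fin n → ℕ) → sumFin f ≡ sum f
  sumFin≡sum {zero}  f = refl
  sumFin≡sum {suc n} f = cong (f zero +_) (sumFin≡sum (f ∘ suc))

  sumFin-+ : ∀ {n} (f g : Fin n → ℕ) → sumFin (λ i → f i + g i) ≡ sumFin f + sumFin g
  sumFin-+ f g = begin
    sumFin (λ i → f i + g i)  ≡⟨ sumFin≡sum (λ i → f i + g i) ⟩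
    sum (λ i → f i + g i)     ≡⟨ ∑-distrib-+ f g ⟩
    sum f + sum g             ≡⟨ sym (cong₂ _+_ (sumFin≡sum f) (sumFin≡sum g)) ⟩
    sumFin f + sumFin g       ∎
    where open ≡-Reasoning

  sumFin-*ˡ : ∀ {n} c (f : Fin n → ℕ) → sumFin (λ i → c * f i) ≡ c * sumFin f
  sumFin-*ˡ c f = begin
    sumFin (λ i → c * f i)  ≡⟨ sumFin≡sum (λ i → c * f i) ⟩
    sum (λ i → c * f i)     ≡⟨ sym (*-distribˡ-sum c f) ⟩
    c * sum f               ≡⟨ cong (c *_) (sym (sumFin≡sum f)) ⟩
    c * sumFin f            ∎
    where open ≡-Reasoning

  sumFin-swap : ∀ {m n} (f : Fin m → Fin n → ℕ) →
                sumFin (λ i → sumFin (f i)) ≡ sumFin (λ j → sumFin (λ i → f i j))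
  sumFin-swap f = begin
    sumFin (λ i → sumFin (f i))          ≡⟨ sumFin²≡sum² f ⟩
    sum (λ i → sum (f i))                ≡⟨ ∑-comm f ⟩
    sum (λ j → sum (λ i → f i j))        ≡⟨ sym (sumFin²≡sum² (λ j i → f i j)) ⟩
    sumFin (λ j → sumFin (λ i → f i j))  ∎
    where
    open ≡-Reasoning
    sumFin²≡sum² : ∀ {m n} (g : Fin m → Fin n → ℕ) → sumFin (λ i → sumFin (g i)) ≡ sum (λ i → sum (g i))
    sumFin²≡sum² g = trans (sumFin-cong (λ i → sumFin≡sum (g i))) (sumFin≡sum (λ i → sum (g i)))

  if-T : ∀ {b} {x y : ℕ} → T b → (if b then x else y) ≡ x
  if-T {true} _ = refl

  if-¬T : ∀ {b} {x y : ℕ} → ¬ T b → (if b then x else y) ≡ y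
  if-¬T {true}  ¬t = ⊥-elim (¬t _)
  if-¬T {false} _  = refl

  if-as-* : ∀ b (x : ℕ) → (if b then x else 0) ≡ x * (if b then 1 else 0)
  if-as-* true  x = sym (*-identityʳ x)
  if-as-* false x = sym (*-zeroʳ x)

  if-+ : ∀ c (x y : ℕ) → (if c then x + y else 0) ≡ (if c then x else 0) + (if c then y else 0)
  if-+ true  x y = refl
  if-+ false x y = refl

  if-mono : ∀ c {x y : ℕ} → x ≤ y → (if c then x else 0) ≤ (if c then y else 0)
  if-mono true  x≤y = x≤y
  if-mono false x≤y = z≤n

  if-∧ : ∀ a c (x : ℕ) → (if a ∧ c then x else 0) ≡ (if a then (if c then x else 0) else 0)
  if-∧ true  c x = refl
  if-∧ false c x = refl

  sumFin-if : ∀ {m} a (g : Fin m → ℕ) → sumFin (λ j → if a then g j else 0) ≡ (if a then sumFin g else 0)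
  sumFin-if true  g = refl
  sumFin-if {m} false g = sumFin-zero {m} (λ _ → refl)

  sumFin-unique : ∀ {n} (b : Fin n → Bool) {i₀} → (∀ i → T (b i) ⇔ i ≡ i₀) → (g : Fin n → ℕ) →
                  sumFin (λ i → if b i then g i else 0) ≡ g i₀
  sumFin-unique {suc n} b {zero} b⇔ g = begin
    (if b zero then g zero else 0) + sumFin (λ j → if b (suc j) then g (suc j) else 0)
      ≡⟨ cong₂ _+_ (if-T (from (b⇔ zero) refl)) (sumFin-zero (λ j → if-¬T (0≢1+n ∘ sym ∘ to (b⇔ (suc j))))) ⟩
    g zero + 0
      ≡⟨ +-identityʳ _ ⟩
    g zero ∎
    where open ≡-Reasoning
  sumFin-unique {suc n} b {suc i₀} b⇔ g =
    cong₂ _+_ (if-¬T (0≢1+n ∘ to (b⇔ zero)))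
              (sumFin-unique (b ∘ suc) (λ j → mk⇔ (suc-injective ∘ to (b⇔ (suc j))) (from (b⇔ (suc j)) ∘ cong suc))
                             (g ∘ suc))

  sumFin-none : ∀ {n} (b : Fin n → Bool) → (∀ i → ¬ T (b i)) → (g : Fin n → ℕ) →
                sumFin (λ i → if b i then g i else 0) ≡ 0
  sumFin-none b ¬b g = sumFin-zero (λ i → if-¬T (¬b i))

  module _ {s n} (f : Fin s → Fin n) (f-inj : Injective _≡_ _≡_ f) where

    sumFin-preimage : ∀ {u i₀} → f i₀ ≡ u → (g : Fin s → ℕ) →
                      sumFin (λ i → if ⌊ f i ≟ u ⌋ then g i else 0) ≡ g i₀
    sumFin-preimage {u} {i₀} fi₀≡u = sumFin-unique (λ i → ⌊ f i ≟ u ⌋) preimage⇔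
      where
      preimage⇔ : ∀ i → T ⌊ f i ≟ u ⌋ ⇔ i ≡ i₀
      preimage⇔ i = mk⇔ (λ t → f-inj (trans (toWitness t) (sym fi₀≡u)))
                        (λ i≡i₀ → fromWitness (trans (cong f i≡i₀) fi₀≡u))

    sumFin-preimage-∅ : ∀ {u} → (∀ i → f i ≢ u) → (g : Fin s → ℕ) →
                        sumFin (λ i → if ⌊ f i ≟ u ⌋ then g i else 0) ≡ 0
    sumFin-preimage-∅ {u} ∉f = sumFin-none (λ i → ⌊ f i ≟ u ⌋) (λ i → ∉f i ∘ toWitness)

    sumFin-reindex : (g : Fin n → ℕ) → (∀ u → (∀ i → f i ≢ u) → g u ≡ 0) → sumFin g ≡ sumFin (g ∘ f)
    sumFin-reindex g g-off = begin
      sumFin g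
        ≡⟨ sumFin-cong count-preimage ⟩
      sumFin (λ u → sumFin (λ i → if ⌊ f i ≟ u ⌋ then g u else 0))
        ≡⟨ sumFin-swap (λ u i → if ⌊ f i ≟ u ⌋ then g u else 0) ⟩
      sumFin (λ i → sumFin (λ u → if ⌊ f i ≟ u ⌋ then g u else 0))
        ≡⟨ sumFin-cong (λ i → sumFin-unique (λ u → ⌊ f i ≟ u ⌋)
                                            (λ u → mk⇔ (sym ∘ toWitness) (fromWitness ∘ sym)) g) ⟩
      sumFin (g ∘ f) ∎
      where
      open ≡-Reasoning
      count-preimage : ∀ u → g u ≡ sumFin (λ i → if ⌊ f i ≟ u ⌋ then g u else 0)
      count-preimage u with any? (λ i → f i ≟ u)
      ... | yes (i₀ , fi₀≡u) = sym (sumFin-preimage fi₀≡u (λ _ → g u))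
      ... | no  ∉f           = trans (g-off u ∉f′) (sym (sumFin-preimage-∅ ∉f′ (λ _ → g u)))
        where
        ∉f′ : ∀ i → f i ≢ u
        ∉f′ i fi≡u = ∉f (i , fi≡u)

    restrict : (Fin n → ℕ) → Fin n → ℕ
    restrict g u = if ⌊ any? (λ i → f i ≟ u) ⌋ then g u else 0

    sumFin-restrict : (g : Fin n → ℕ) → sumFin (restrict g) ≡ sumFin (g ∘ f)
    sumFin-restrict g = trans (sumFin-reindex (restrict g) restrict-off) (sumFin-cong restrict-on)
      where
      restrict-off : ∀ u → (∀ i → f i ≢ u) → restrict g u ≡ 0
      restrict-off u ∉f with any? (λ i → f i ≟ u)
      ... | yes (i , fi≡u) = ⊥-elim (∉f i fi≡u)
      ... | no _           = refl
      restrict-on : ∀ i → restrict g (f i) ≡ g (f i)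
      restrict-on i with any? (λ j → f j ≟ f i)
      ... | yes _ = refl
      ... | no ∉f = ⊥-elim (∉f (i , refl))

    sumFin-exchange : (g g′ : Fin n → ℕ) → (∀ u → (∀ i → f i ≢ u) → g u ≡ g′ u) →
                      sumFin g + sumFin (g′ ∘ f) ≡ sumFin g′ + sumFin (g ∘ f)
    sumFin-exchange g g′ agree = begin
      sumFin g + sumFin (g′ ∘ f)          ≡⟨ cong (sumFin g +_) (sumFin-restrict g′) ⟨
      sumFin g + sumFin (restrict g′)     ≡⟨ sumFin-+ g (restrict g′) ⟨
      sumFin (λ u → g u + restrict g′ u)  ≡⟨ sumFin-cong swap ⟩
      sumFin (λ u → g′ u + restrict g u)  ≡⟨ sumFin-+ g′ (restrict g) ⟩
      sumFin g′ + sumFin (restrict g)     ≡⟨ cong (sumFin g′ +_) (sumFin-restrict g) ⟩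
      sumFin g′ + sumFin (g ∘ f)          ∎
      where
      open ≡-Reasoning
      swap : ∀ u → g u + restrict g′ u ≡ g′ u + restrict g u
      swap u with any? (λ i → f i ≟ u)
      ... | yes _ = +-comm (g u) (g′ u)
      ... | no ∉f = cong (_+ 0) (agree u (λ i fi≡u → ∉f (i , fi≡u)))

    sumFin-≤-from-image : (g g′ : Fin n → ℕ) → (∀ u → (∀ i → f i ≢ u) → g u ≡ g′ u) → ∀ x y →
                          sumFin (g ∘ f) + x ≤ sumFin (g′ ∘ f) + y → sumFin g + x ≤ sumFin g′ + y
    sumFin-≤-from-image g g′ agree x y on-image = +-cancelʳ-≤ (sumFin (g′ ∘ f)) _ _ (begin
      sumFin g + x + sumFin (g′ ∘ f)    ≡⟨ xy∙z≈xz∙y (sumFin g) x _ ⟩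
      sumFin g + sumFin (g′ ∘ f) + x    ≡⟨ cong (_+ x) (sumFin-exchange g g′ agree) ⟩
      sumFin g′ + sumFin (g ∘ f) + x    ≡⟨ +-assoc (sumFin g′) _ x ⟩
      sumFin g′ + (sumFin (g ∘ f) + x)  ≤⟨ +-monoʳ-≤ (sumFin g′) on-image ⟩
      sumFin g′ + (sumFin (g′ ∘ f) + y) ≡⟨ x∙yz≈xz∙y (sumFin g′) _ y ⟩
      sumFin g′ + y + sumFin (g′ ∘ f)   ∎)
      where open ≤-Reasoning

  sumFin-all-but-one : ∀ {s} (F : Fin s → ℕ) i₀ y → (∀ i → i ≢ i₀ → F i ≡ y) → sumFin F + y ≡ F i₀ + s * y
  sumFin-all-but-one {s} F i₀ y F≡y = begin
    sumFin F + y
      ≡⟨ cong (sumFin F +_) (sumFin-preimage {s} id id refl (λ _ → y)) ⟨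
    sumFin F + sumFin (λ i → if ⌊ i ≟ i₀ ⌋ then y else 0)
      ≡⟨ sumFin-+ F (λ i → if ⌊ i ≟ i₀ ⌋ then y else 0) ⟨
    sumFin (λ i → F i + (if ⌊ i ≟ i₀ ⌋ then y else 0))
      ≡⟨ sumFin-cong move ⟩
    sumFin (λ i → (if ⌊ i ≟ i₀ ⌋ then F i else 0) + y)
      ≡⟨ sumFin-+ (λ i → if ⌊ i ≟ i₀ ⌋ then F i else 0) (λ _ → y) ⟩
    sumFin (λ i → if ⌊ i ≟ i₀ ⌋ then F i else 0) + sumFin {s} (λ _ → y)
      ≡⟨ cong₂ _+_ (sumFin-preimage id id refl F) (sumFin-const {s} y) ⟩
    F i₀ + s * y ∎
    where
    open ≡-Reasoning
    move : ∀ i → F i + (if ⌊ i ≟ i₀ ⌋ then y else 0) ≡ (if ⌊ i ≟ i₀ ⌋ then F i else 0) + y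
    move i with i ≟ i₀
    ... | yes _    = refl
    ... | no  i≢i₀ = trans (+-identityʳ (F i)) (F≡y i i≢i₀)

  countFin-toℕ : ∀ {s} (b : Fin s → Bool) {y} → y < s → (∀ j → T (b j) ⇔ toℕ j ≡ y) → countFin b ≡ 1
  countFin-toℕ {s} b {y} y<s b⇔ = sumFin-unique b (λ j → mk⇔ (at-y ∘ to (b⇔ j)) (from (b⇔ j) ∘ from-y)) (λ _ → 1)
    where
    at-y : ∀ {j : Fin s} → toℕ j ≡ y → j ≡ fromℕ< y<s
    at-y eq = toℕ-injective (trans eq (sym (toℕ-fromℕ< y<s)))
    from-y : ∀ {j : Fin s} → j ≡ fromℕ< y<s → toℕ j ≡ y
    from-y refl = toℕ-fromℕ< y<s

  countFin-∨ : ∀ {s} (a b : Fin s → Bool) → (∀ j → T (a j) → T (b j) → ⊥) →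
               countFin (λ j → a j ∨ b j) ≡ countFin a + countFin b
  countFin-∨ a b disjoint = trans (sumFin-cong split) (sumFin-+ (λ j → if a j then 1 else 0) (λ j → if b j then 1 else 0))
    where
    split : ∀ j → (if a j ∨ b j then 1 else 0) ≡ (if a j then 1 else 0) + (if b j then 1 else 0)
    split j with a j | b j | disjoint j
    ... | true  | true  | d = ⊥-elim (d _ _)
    ... | true  | false | _ = refl
    ... | false | _     | _ = refl

  countFin-not : ∀ {s} (b : Fin s → Bool) → countFin (λ j → not (b j)) + countFin b ≡ s
  countFin-not {s} b = begin
    countFin (λ j → not (b j)) + countFin b
      ≡⟨ sumFin-+ (λ j → if not (b j) then 1 else 0) (λ j → if b j then 1 else 0) ⟨
    sumFin (λ j → (if not (b j) then 1 else 0) + (if b j then 1 else 0))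
      ≡⟨ sumFin-cong complement ⟩
    sumFin {s} (λ _ → 1)
      ≡⟨ sumFin-const {s} 1 ⟩
    s * 1
      ≡⟨ *-identityʳ s ⟩
    s ∎
    where
    open ≡-Reasoning
    complement : ∀ j → (if not (b j) then 1 else 0) + (if b j then 1 else 0) ≡ 1
    complement j with b j
    ... | true  = refl
    ... | false = refl

  countFin-below+at : ∀ {n} (f : Fin n → ℕ) k → (∀ v → f v ≤ k) →
                      countFin (λ v → f v <ᵇ k) + countFin (λ v → f v ≡ᵇ k) ≡ n
  countFin-below+at {n} f k f≤k = begin
    countFin (λ v → f v <ᵇ k) + countFin (λ v → f v ≡ᵇ k)
      ≡⟨ sumFin-+ (λ v → if f v <ᵇ k then 1 else 0) (λ v → if f v ≡ᵇ k then 1 else 0) ⟨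
    sumFin (λ v → (if f v <ᵇ k then 1 else 0) + (if f v ≡ᵇ k then 1 else 0))
      ≡⟨ sumFin-cong exactly-one ⟩
    sumFin {n} (λ _ → 1)
      ≡⟨ trans (sumFin-const {n} 1) (*-identityʳ n) ⟩
    n ∎
    where
    open ≡-Reasoning
    exactly-one : ∀ v → (if f v <ᵇ k then 1 else 0) + (if f v ≡ᵇ k then 1 else 0) ≡ 1
    exactly-one v with f v <ᵇ k | <ᵇ-reflects-< (f v) k | f v ≡ᵇ k | proof (f v ℕ.≟ k)
    ... | true  | ofʸ f<k | true  | ofʸ f≡k = ⊥-elim (<-irrefl f≡k f<k)
    ... | true  | _       | false | _       = refl
    ... | false | _       | true  | _       = refl
    ... | false | ofⁿ f≮k | false | ofⁿ f≢k = ⊥-elim (f≮k (≤∧≢⇒< (f≤k v) f≢k))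

  sumPairs-cong : ∀ {n} {f g : Fin n → Fin n → ℕ} → (∀ u v → f u v ≡ g u v) → sumPairs f ≡ sumPairs g
  sumPairs-cong eq = sumFin-cong (λ u → sumFin-cong (λ v → cong (λ x → if toℕ u <ᵇ toℕ v then x else 0) (eq u v)))

  sumPairs-+ : ∀ {n} (f g : Fin n → Fin n → ℕ) → sumPairs (λ u v → f u v + g u v) ≡ sumPairs f + sumPairs g
  sumPairs-+ {n} f g = trans (sumFin-cong (λ u → trans (sumFin-cong (λ v → if-+ (toℕ u <ᵇ toℕ v) (f u v) (g u v)))
                                                   (sumFin-+ (below f u) (below g u))))
                         (sumFin-+ (λ u → sumFin (below f u)) (λ u → sumFin (below g u)))
    where
    below : (Fin n → Fin n → ℕ) → Fin n → Fin n → ℕ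
    below h u v = if toℕ u <ᵇ toℕ v then h u v else 0

  sumPairs-mono : ∀ {n} {f g : Fin n → Fin n → ℕ} → (∀ u v → f u v ≤ g u v) → sumPairs f ≤ sumPairs g
  sumPairs-mono le = sumFin-mono (λ u → sumFin-mono (λ v → if-mono (toℕ u <ᵇ toℕ v) (le u v)))

  split-by-order : ∀ m n x → (m ≡ n → x ≡ 0) → x ≡ (if m <ᵇ n then x else 0) + (if n <ᵇ m then x else 0)
  split-by-order m n x diag with m <ᵇ n | <ᵇ-reflects-< m n | n <ᵇ m | <ᵇ-reflects-< n m
  ... | true  | ofʸ m<n | true  | ofʸ n<m = ⊥-elim (<-asym m<n n<m)
  ... | true  | _       | false | _       = sym (+-identityʳ x)
  ... | false | _       | true  | _       = refl
  ... | false | ofⁿ m≮n | false | ofⁿ n≮m = diag (≤-antisym (≮⇒≥ n≮m) (≮⇒≥ m≮n))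

  sumPairs-double : ∀ {n} (f : Fin n → Fin n → ℕ) → (∀ u v → f u v ≡ f v u) → (∀ u → f u u ≡ 0) →
                    2 * sumPairs f ≡ sumFin (λ u → sumFin (f u))
  sumPairs-double {n} f f-sym f-diag = sym (begin
    sumFin (λ u → sumFin (f u))
      ≡⟨ sumFin-cong (λ u → sumFin-cong (λ v → split-by-order (toℕ u) (toℕ v) (f u v) (diag u v))) ⟩
    sumFin (λ u → sumFin (λ v → below u v + above u v))
      ≡⟨ sumFin-cong (λ u → sumFin-+ (below u) (above u)) ⟩
    sumFin (λ u → sumFin (below u) + sumFin (above u))
      ≡⟨ sumFin-+ (λ u → sumFin (below u)) (λ u → sumFin (above u)) ⟩
    sumPairs f + sumFin (λ u → sumFin (above u))
      ≡⟨ cong (sumPairs f +_) (sumFin-swap above) ⟩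
    sumPairs f + sumPairs (λ v u → f u v)
      ≡⟨ cong (sumPairs f +_) (trans (sumPairs-cong (λ v u → f-sym u v)) (sym (+-identityʳ _))) ⟩
    2 * sumPairs f ∎)
    where
    open ≡-Reasoning
    below above : Fin n → Fin n → ℕ
    below u v = if toℕ u <ᵇ toℕ v then f u v else 0
    above u v = if toℕ v <ᵇ toℕ u then f u v else 0
    diag : ∀ u v → toℕ u ≡ toℕ v → f u v ≡ 0
    diag u v eq rewrite toℕ-injective eq = f-diag v

module Shapes where

  open FiniteSums
  open import Data.Nat using (ℕ; zero; suc; _+_; _∸_; _≤_; _<_; z≤n; s≤s; _≡ᵇ_; _≟_)
  open import Data.Nat.Properties
    using (suc-injective; ≡ᵇ⇒≡; ≡⇒≡ᵇ; ≤∧≢⇒<; <-irrefl; <-trans; n<1+n; ≤-trans; ≤-refl; ≤⇒≯; m+n∸n≡m)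
  open import Data.Fin using (Fin; toℕ) renaming (_≟_ to _≟ᶠ_)
  open import Data.Fin.Properties using (toℕ<n)
  open import Data.Bool using (T; _∧_; _∨_)
  open import Data.Bool.Properties using (T-∨; T-∧; ∨-comm)
  open import Data.Empty using (⊥; ⊥-elim)
  open import Data.Product as Product using (_×_; _,_)
  open import Data.Sum using (_⊎_; inj₁; inj₂; reduce)
  open import Function using (_∘_; _⇔_; mk⇔; Equivalence)
  open import Function.Construct.Composition using (_⇔-∘_)
  open import Relation.Nullary using (¬_; yes; no)
  open import Relation.Nullary.Decidable using (⌊_⌋; toWitness; fromWitness)
  open import Relation.Binary.PropositionalEquality
  open Equivalence

  skeletonDegree : Shape → ℕ → ℕ
  skeletonDegree K s = s ∸ 1
  skeletonDegree C s = 2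

  count-complete : ∀ {s} (i : Fin s) → countFin (adjShape K s i) ≡ s ∸ 1
  count-complete {s} i = begin
    countFin (adjShape K s i)
      ≡⟨ m+n∸n≡m (countFin (adjShape K s i)) 1 ⟨
    countFin (adjShape K s i) + 1 ∸ 1
      ≡⟨ cong (λ c → countFin (adjShape K s i) + c ∸ 1) diagonal ⟨
    countFin (adjShape K s i) + countFin (λ j → ⌊ i ≟ᶠ j ⌋) ∸ 1
      ≡⟨ cong (_∸ 1) (countFin-not (λ j → ⌊ i ≟ᶠ j ⌋)) ⟩
    s ∸ 1 ∎
    where
    open ≡-Reasoning
    diagonal : countFin (λ j → ⌊ i ≟ᶠ j ⌋) ≡ 1
    diagonal = sumFin-unique (λ j → ⌊ i ≟ᶠ j ⌋) (λ j → mk⇔ (sym ∘ toWitness) (fromWitness ∘ sym)) (λ _ → 1)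

  Follows : ℕ → ℕ → ℕ → Set
  Follows s x y = suc x ≡ y ⊎ (suc x ≡ s × y ≡ 0)

  T-cycle⇔Follows : ∀ s x y → T ((suc x ≡ᵇ y) ∨ ((suc x ≡ᵇ s) ∧ (y ≡ᵇ 0))) ⇔ Follows s x y
  T-cycle⇔Follows s x y = mk⇔ follows cycle
    where
    follows : T ((suc x ≡ᵇ y) ∨ ((suc x ≡ᵇ s) ∧ (y ≡ᵇ 0))) → Follows s x y
    follows t with to (T-∨ {suc x ≡ᵇ y}) t
    ... | inj₁ t₁ = inj₁ (≡ᵇ⇒≡ _ _ t₁)
    ... | inj₂ t₂ = inj₂ (Product.map (≡ᵇ⇒≡ _ _) (≡ᵇ⇒≡ _ _) (to (T-∧ {suc x ≡ᵇ s}) t₂))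
    cycle : Follows s x y → T ((suc x ≡ᵇ y) ∨ ((suc x ≡ᵇ s) ∧ (y ≡ᵇ 0)))
    cycle (inj₁ eq)         = from T-∨ (inj₁ (≡⇒≡ᵇ _ _ eq))
    cycle (inj₂ (eq , eq′)) = from T-∨ (inj₂ (from T-∧ (≡⇒≡ᵇ _ _ eq , ≡⇒≡ᵇ _ _ eq′)))

  Follows-irrefl : ∀ {s x} → Follows s x x → s ≤ 1
  Follows-irrefl (inj₂ (refl , refl)) = ≤-refl

  Follows-asym : ∀ {s x y} → Follows s x y → Follows s y x → s ≤ 2
  Follows-asym (inj₁ refl)          (inj₁ ())
  Follows-asym (inj₁ refl)          (inj₂ (refl , refl)) = ≤-refl
  Follows-asym (inj₂ (refl , refl)) (inj₁ refl)          = ≤-refl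
  Follows-asym (inj₂ (refl , refl)) (inj₂ (refl , refl)) = s≤s z≤n

  count-successor : ∀ {s} x → x < s →
                    countFin {s} (λ j → (suc x ≡ᵇ toℕ j) ∨ ((suc x ≡ᵇ s) ∧ (toℕ j ≡ᵇ 0))) ≡ 1
  count-successor {s} x x<s with suc x ≟ s
  ... | yes 1+x≡s = countFin-toℕ _ (≤-trans (s≤s z≤n) x<s)
                      (λ j → mk⇔ (wraps j) (λ j≡0 → inj₂ (1+x≡s , j≡0)) ⇔-∘ T-cycle⇔Follows s x (toℕ j))
    where
    wraps : ∀ j → Follows s x (toℕ j) → toℕ j ≡ 0
    wraps j (inj₁ eq)      = ⊥-elim (<-irrefl (trans (sym eq) 1+x≡s) (toℕ<n j))
    wraps j (inj₂ (_ , eq)) = eq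
  ... | no 1+x≢s = countFin-toℕ _ (≤∧≢⇒< x<s 1+x≢s)
                     (λ j → mk⇔ steps (inj₁ ∘ sym) ⇔-∘ T-cycle⇔Follows s x (toℕ j))
    where
    steps : ∀ {y} → Follows s x y → y ≡ suc x
    steps (inj₁ eq)      = sym eq
    steps (inj₂ (eq , _)) = ⊥-elim (1+x≢s eq)

  count-predecessor : ∀ {s} x → x < s →
                      countFin {s} (λ j → (suc (toℕ j) ≡ᵇ x) ∨ ((suc (toℕ j) ≡ᵇ s) ∧ (x ≡ᵇ 0))) ≡ 1
  count-predecessor {suc s} zero _ = countFin-toℕ _ (n<1+n s)
    (λ j → mk⇔ wraps (λ eq → inj₂ (cong suc eq , refl)) ⇔-∘ T-cycle⇔Follows (suc s) (toℕ j) 0)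
    where
    wraps : ∀ {y} → Follows (suc s) y 0 → y ≡ s
    wraps (inj₂ (eq , _)) = suc-injective eq
  count-predecessor {suc s} (suc x) x<s = countFin-toℕ _ (<-trans (n<1+n x) x<s)
    (λ j → mk⇔ steps (inj₁ ∘ cong suc) ⇔-∘ T-cycle⇔Follows (suc s) (toℕ j) (suc x))
    where
    steps : ∀ {y} → Follows (suc s) y (suc x) → y ≡ x
    steps (inj₁ eq) = suc-injective eq

  adjShape-count : ∀ sh {s} → ValidSize sh s → ∀ i → countFin (adjShape sh s i) ≡ skeletonDegree sh s
  adjShape-count K _ i = count-complete i
  adjShape-count C {s} 3≤s i = begin
    countFin (λ j → succAdj s i j ∨ succAdj s j i)
      ≡⟨ countFin-∨ (succAdj s i) (λ j → succAdj s j i) disjoint ⟩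
    countFin (succAdj s i) + countFin (λ j → succAdj s j i)
      ≡⟨ cong₂ _+_ (count-successor (toℕ i) (toℕ<n i)) (count-predecessor (toℕ i) (toℕ<n i)) ⟩
    2 ∎
    where
    open ≡-Reasoning
    disjoint : ∀ j → T (succAdj s i j) → T (succAdj s j i) → ⊥
    disjoint j t t′ = ≤⇒≯ (Follows-asym (to (T-cycle⇔Follows s (toℕ i) (toℕ j)) t)
                                        (to (T-cycle⇔Follows s (toℕ j) (toℕ i)) t′)) 3≤s

  adjShape-sym : ∀ sh s (i j : Fin s) → adjShape sh s i j ≡ adjShape sh s j i
  adjShape-sym K s i j with i ≟ᶠ j | j ≟ᶠ i
  ... | yes _   | yes _   = refl
  ... | no  _   | no  _   = refl
  ... | yes i≡j | no  j≢i = ⊥-elim (j≢i (sym i≡j))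
  ... | no  i≢j | yes j≡i = ⊥-elim (i≢j (sym j≡i))
  adjShape-sym C s i j = ∨-comm (succAdj s i j) (succAdj s j i)

  adjShape-irrefl : ∀ sh {s} → ValidSize sh s → ∀ i → ¬ T (adjShape sh s i i)
  adjShape-irrefl K _ i with i ≟ᶠ i
  ... | yes _  = λ ()
  ... | no i≢i = ⊥-elim (i≢i refl)
  adjShape-irrefl C {s} 3≤s i t =
    ≤⇒≯ (Follows-irrefl (to (T-cycle⇔Follows s (toℕ i) (toℕ i)) (reduce (to T-∨ t))))
        (≤-trans (s≤s (s≤s z≤n)) 3≤s)

  skeletonDegree-pos : ∀ sh {s} → ValidSize sh s → 1 ≤ skeletonDegree sh s
  skeletonDegree-pos K (s≤s (s≤s _)) = s≤s z≤n
  skeletonDegree-pos C _             = s≤s z≤n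

  skeletonDegree-< : ∀ sh {s} → ValidSize sh s → skeletonDegree sh s < s
  skeletonDegree-< K (s≤s (s≤s {n = s} _)) = n<1+n (suc s)
  skeletonDegree-< C 3≤s                    = 3≤s

module Blocks where

  open FiniteSums
  open Shapes
  open import Data.Nat using (ℕ; zero; suc; _+_; _*_; _∸_; _≤_; s≤s; z≤n; _≤ᵇ_; _<ᵇ_)
  open import Data.Nat.Properties
    using (*-mono-≤; *-monoˡ-≤; *-cancelˡ-≤; +-monoʳ-≤; m≤m+n; m≤n+m; m+n≤o⇒n≤o; ≤-trans; module ≤-Reasoning)
  open import Data.Fin using (Fin; toℕ; _≟_)
  open import Data.List using (List; []; _∷_)
  open import Data.List.Membership.Propositional using (_∈_)
  open import Data.List.Relation.Unary.Any using (here; there)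
  open import Data.Fin.Properties using (any?)
  open import Data.Bool using (Bool; if_then_else_; _∧_)
  open import Data.Product using (∃; _,_)
  open import Data.Sum using (_⊎_; inj₁; inj₂)
  open import Data.Bool.Properties using (if-eta; if-float)
  open import Function using (_∘_)
  open import Relation.Nullary using (¬_; yes; no)
  open import Relation.Nullary.Decidable using (⌊_⌋)
  open import Relation.Binary.PropositionalEquality

  module _ {n} (B : Block n) where

    adjacent : Fin (size B) → Fin (size B) → Bool
    adjacent = adjShape (shape B) (size B)

    edge : Fin (size B) → Fin (size B) → ℕ
    edge i j = if adjacent i j then mul B else 0

    skeletonDegreeB : ℕ
    skeletonDegreeB = skeletonDegree (shape B) (size B)

    blockDegree : ℕ
    blockDegree = mul B * skeletonDegreeB

    degB : Fin n → ℕ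
    degB v = sumFin (blockMult B v)

    mB : ℕ
    mB = sumPairs (λ u v → blockMult B u v ∸ 1)

    sumFin-adjacent : ∀ i x → sumFin (λ j → if adjacent i j then x else 0) ≡ x * skeletonDegreeB
    sumFin-adjacent i x = begin
      sumFin (λ j → if adjacent i j then x else 0)
        ≡⟨ sumFin-cong (λ j → if-as-* (adjacent i j) x) ⟩
      sumFin (λ j → x * (if adjacent i j then 1 else 0))
        ≡⟨ sumFin-*ˡ x (λ j → if adjacent i j then 1 else 0) ⟩
      x * countFin (adjacent i)
        ≡⟨ cong (x *_) (adjShape-count (shape B) (size-ok B) i) ⟩
      x * skeletonDegreeB ∎
      where open ≡-Reasoning

    blockMult-unfold : ∀ u v → blockMult B u v ≡
      sumFin (λ i → if ⌊ vert B i ≟ u ⌋ then sumFin (λ j → if ⌊ vert B j ≟ v ⌋ then edge i j else 0) else 0)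
    blockMult-unfold u v = sumFin-cong (λ i → begin
      sumFin (λ j → if ⌊ vert B i ≟ u ⌋ ∧ (⌊ vert B j ≟ v ⌋ ∧ adjacent i j) then mul B else 0)
        ≡⟨ sumFin-cong (λ j → if-∧ ⌊ vert B i ≟ u ⌋ (⌊ vert B j ≟ v ⌋ ∧ adjacent i j) (mul B)) ⟩
      sumFin (λ j → if ⌊ vert B i ≟ u ⌋ then (if ⌊ vert B j ≟ v ⌋ ∧ adjacent i j then mul B else 0) else 0)
        ≡⟨ sumFin-if ⌊ vert B i ≟ u ⌋ (λ j → if ⌊ vert B j ≟ v ⌋ ∧ adjacent i j then mul B else 0) ⟩
      (if ⌊ vert B i ≟ u ⌋ then sumFin (λ j → if ⌊ vert B j ≟ v ⌋ ∧ adjacent i j then mul B else 0) else 0)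
        ≡⟨ cong (λ x → if ⌊ vert B i ≟ u ⌋ then x else 0)
                (sumFin-cong (λ j → if-∧ ⌊ vert B j ≟ v ⌋ (adjacent i j) (mul B))) ⟩
      (if ⌊ vert B i ≟ u ⌋ then sumFin (λ j → if ⌊ vert B j ≟ v ⌋ then edge i j else 0) else 0) ∎)
      where open ≡-Reasoning

    blockMult-vert : ∀ i j → blockMult B (vert B i) (vert B j) ≡ edge i j
    blockMult-vert i j = begin
      blockMult B (vert B i) (vert B j)
        ≡⟨ blockMult-unfold (vert B i) (vert B j) ⟩
      sumFin (λ i′ → if ⌊ vert B i′ ≟ vert B i ⌋ then row i′ else 0)
        ≡⟨ sumFin-preimage (vert B) (vert-inj B) refl row ⟩
      sumFin (λ j′ → if ⌊ vert B j′ ≟ vert B j ⌋ then edge i j′ else 0)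
        ≡⟨ sumFin-preimage (vert B) (vert-inj B) refl (edge i) ⟩
      edge i j ∎
      where
      open ≡-Reasoning
      row : Fin (size B) → ℕ
      row i′ = sumFin (λ j′ → if ⌊ vert B j′ ≟ vert B j ⌋ then edge i′ j′ else 0)

    blockMult-outˡ : ∀ {u} v → (∀ i → vert B i ≢ u) → blockMult B u v ≡ 0
    blockMult-outˡ v ∉B = trans (blockMult-unfold _ v) (sumFin-preimage-∅ (vert B) (vert-inj B) ∉B _)

    blockMult-outʳ : ∀ u {v} → (∀ j → vert B j ≢ v) → blockMult B u v ≡ 0
    blockMult-outʳ u ∉B = trans (blockMult-unfold u _)
      (sumFin-zero (λ i → trans (cong (λ x → if ⌊ vert B i ≟ u ⌋ then x else 0)
                                      (sumFin-preimage-∅ (vert B) (vert-inj B) ∉B (edge i)))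
                                (if-eta ⌊ vert B i ≟ u ⌋)))

    vert? : ∀ u → (∃ λ i → vert B i ≡ u) ⊎ (∀ i → vert B i ≢ u)
    vert? u with any? (λ i → vert B i ≟ u)
    ... | yes u∈B = inj₁ u∈B
    ... | no  u∉B = inj₂ (λ i eq → u∉B (i , eq))

    blockMult-sym : ∀ u v → blockMult B u v ≡ blockMult B v u
    blockMult-sym u v with vert? u | vert? v
    ... | inj₁ (i , refl) | inj₁ (j , refl) = trans (blockMult-vert i j)
      (trans (cong (λ b → if b then mul B else 0) (adjShape-sym (shape B) (size B) i j)) (sym (blockMult-vert j i)))
    ... | inj₂ u∉B | _        = trans (blockMult-outˡ v u∉B) (sym (blockMult-outʳ v u∉B))
    ... | inj₁ _   | inj₂ v∉B = trans (blockMult-outʳ u v∉B) (sym (blockMult-outˡ u v∉B))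

    blockMult-diag : ∀ u → blockMult B u u ≡ 0
    blockMult-diag u with vert? u
    ... | inj₁ (i , refl) = trans (blockMult-vert i i) (if-¬T (adjShape-irrefl (shape B) (size-ok B) i))
    ... | inj₂ u∉B        = blockMult-outˡ u u∉B

    degB-vert : ∀ i → degB (vert B i) ≡ blockDegree
    degB-vert i = begin
      sumFin (blockMult B (vert B i))
        ≡⟨ sumFin-reindex (vert B) (vert-inj B) _ (λ v → blockMult-outʳ (vert B i)) ⟩
      sumFin (λ j → blockMult B (vert B i) (vert B j))
        ≡⟨ sumFin-cong (blockMult-vert i) ⟩
      sumFin (edge i)
        ≡⟨ sumFin-adjacent i (mul B) ⟩
      blockDegree ∎
      where open ≡-Reasoning

    degB-out : ∀ {v} → (∀ i → vert B i ≢ v) → degB v ≡ 0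
    degB-out v∉B = sumFin-zero (λ u → blockMult-outˡ u v∉B)

    blockDegree-pos : 1 ≤ blockDegree
    blockDegree-pos = *-mono-≤ (mul-pos B) (skeletonDegree-pos (shape B) (size-ok B))

    mB-double : 2 * mB ≡ size B * ((mul B ∸ 1) * skeletonDegreeB)
    mB-double = begin
      2 * mB
        ≡⟨ sumPairs-double excess (λ u v → cong (_∸ 1) (blockMult-sym u v)) (λ u → cong (_∸ 1) (blockMult-diag u)) ⟩
      sumFin (λ u → sumFin (excess u))
        ≡⟨ sumFin-reindex (vert B) (vert-inj B) (λ u → sumFin (excess u))
                          (λ u u∉B → sumFin-zero (λ v → cong (_∸ 1) (blockMult-outˡ v u∉B))) ⟩
      sumFin (λ i → sumFin (excess (vert B i)))
        ≡⟨ sumFin-cong (λ i → sumFin-reindex (vert B) (vert-inj B) (excess (vert B i))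
                                             (λ v v∉B → cong (_∸ 1) (blockMult-outʳ (vert B i) v∉B))) ⟩
      sumFin (λ i → sumFin (λ j → excess (vert B i) (vert B j)))
        ≡⟨ sumFin-cong (λ i → sumFin-cong (λ j →
             trans (cong (_∸ 1) (blockMult-vert i j)) (if-float (_∸ 1) (adjacent i j)))) ⟩
      sumFin (λ i → sumFin (λ j → if adjacent i j then mul B ∸ 1 else 0))
        ≡⟨ sumFin-cong (λ i → sumFin-adjacent i (mul B ∸ 1)) ⟩
      sumFin {size B} (λ _ → (mul B ∸ 1) * skeletonDegreeB)
        ≡⟨ sumFin-const {size B} _ ⟩
      size B * ((mul B ∸ 1) * skeletonDegreeB) ∎
      where
      open ≡-Reasoning
      excess : Fin n → Fin n → ℕ
      excess u v = blockMult B u v ∸ 1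

    size-≥2 : 2 ≤ size B
    size-≥2 = ≤-trans (s≤s (skeletonDegree-pos (shape B) (size-ok B))) (skeletonDegree-< (shape B) (size-ok B))

    mB-≥ : (mul B ∸ 1) * skeletonDegreeB ≤ mB
    mB-≥ = *-cancelˡ-≤ 2 (begin
      2 * ((mul B ∸ 1) * skeletonDegreeB)       ≤⟨ *-monoˡ-≤ _ size-≥2 ⟩
      size B * ((mul B ∸ 1) * skeletonDegreeB)  ≡⟨ mB-double ⟨
      2 * mB                                    ∎)
      where open ≤-Reasoning

  module _ {n : ℕ} where

    multL : List (Block n) → Fin n → Fin n → ℕ
    multL []       u v = 0
    multL (B ∷ bs) u v = blockMult B u v + multL bs u v

    excessL : List (Block n) → Fin n → Fin n → ℕ
    excessL []       u v = 0
    excessL (B ∷ bs) u v = (blockMult B u v ∸ 1) + excessL bs u v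

    degL : List (Block n) → Fin n → ℕ
    degL []       v = 0
    degL (B ∷ bs) v = degB B v + degL bs v

    mL : List (Block n) → ℕ
    mL []       = 0
    mL (B ∷ bs) = mB B + mL bs

    -- mult recurses through a function local to its definition, so it is matched with multL by its equations.
    multL-unique : ∀ u v (g : List (Block n) → ℕ) → g [] ≡ 0 → (∀ B bs → g (B ∷ bs) ≡ blockMult B u v + g bs) →
                   ∀ bs → g bs ≡ multL bs u v
    multL-unique u v g g[] g∷ []       = g[]
    multL-unique u v g g[] g∷ (B ∷ bs) = trans (g∷ B bs) (cong (blockMult B u v +_) (multL-unique u v g g[] g∷ bs))

    mult≡multL : ∀ (T : GDPTree n) u v → mult T u v ≡ multL (blocks T) u v
    mult≡multL T u v with blocks T | multL-unique u v _ refl (λ _ _ → refl)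
    ... | bs | unique = unique bs

    deg≡degL : ∀ (T : GDPTree n) v → deg T v ≡ degL (blocks T) v
    deg≡degL T v = trans (sumFin-cong (mult≡multL T v)) (sumFin-multL (blocks T))
      where
      sumFin-multL : ∀ bs → sumFin (multL bs v) ≡ degL bs v
      sumFin-multL []       = sumFin-zero {n} (λ _ → refl)
      sumFin-multL (B ∷ bs) = trans (sumFin-+ (blockMult B v) (multL bs v)) (cong (degB B v +_) (sumFin-multL bs))

    degL-out : ∀ bs {v} → ¬ InSome bs v → degL bs v ≡ 0
    degL-out []       v∉bs = refl
    degL-out (B ∷ bs) v∉bs = cong₂ _+_ (degB-out B (λ i eq → v∉bs (here (i , eq)))) (degL-out bs (v∉bs ∘ there))

    degB≤degL : ∀ {B bs} → B ∈ bs → ∀ v → degB B v ≤ degL bs v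
    degB≤degL (here refl)          v = m≤m+n _ _
    degB≤degL (there {x = B′} B∈bs) v = ≤-trans (degB≤degL B∈bs v) (m≤n+m _ (degB B′ v))

    skeleton-excess : ∀ bs u v → (if 1 ≤ᵇ multL bs u v then 1 else 0) + excessL bs u v ≤ multL bs u v
    skeleton-excess []       u v = z≤n
    skeleton-excess (B ∷ bs) u v with blockMult B u v | skeleton-excess bs u v
    ... | zero  | ih = ih
    ... | suc x | ih = s≤s (+-monoʳ-≤ x (m+n≤o⇒n≤o _ ih))

    sumPairs-excessL : ∀ bs → sumPairs (excessL bs) ≡ mL bs
    sumPairs-excessL []       = sumFin-zero {n} (λ u → sumFin-zero {n} (λ v → if-eta (toℕ u <ᵇ toℕ v)))
    sumPairs-excessL (B ∷ bs) = trans (sumPairs-+ (λ u v → blockMult B u v ∸ 1) (excessL bs))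
                                      (cong (mB B +_) (sumPairs-excessL bs))

    numSkelEdges+mL≤numEdges : ∀ (T : GDPTree n) → numSkelEdges T + mL (blocks T) ≤ numEdges T
    numSkelEdges+mL≤numEdges T = begin
      numSkelEdges T + mL (blocks T)
        ≡⟨ cong₂ _+_ (sumPairs-cong (λ u v → cong (λ m → if 1 ≤ᵇ m then 1 else 0) (mult≡multL T u v)))
                     (sym (sumPairs-excessL (blocks T))) ⟩
      sumPairs (λ u v → if 1 ≤ᵇ multL (blocks T) u v then 1 else 0) + sumPairs (excessL (blocks T))
        ≡⟨ sumPairs-+ (λ u v → if 1 ≤ᵇ multL (blocks T) u v then 1 else 0) (excessL (blocks T)) ⟨
      sumPairs (λ u v → (if 1 ≤ᵇ multL (blocks T) u v then 1 else 0) + excessL (blocks T) u v)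
        ≤⟨ sumPairs-mono (skeleton-excess (blocks T)) ⟩
      sumPairs (multL (blocks T))
        ≡⟨ sumPairs-cong (λ u v → mult≡multL T u v) ⟨
      numEdges T ∎
      where open ≤-Reasoning

module Arithmetic where

  open import Data.Nat using (zero; suc; pred; _+_; _*_; _⊓_; _≤_)
  open import Data.Nat.Properties
  open import Data.Nat.Tactic.RingSolver using (solve)
  open import Data.List using (_∷_; [])
  open import Relation.Binary.PropositionalEquality
  open ≤-Reasoning

  ≤-offset : ∀ {m n} k → m + k ≡ n → m ≤ n
  ≤-offset {m} k eq = subst (m ≤_) eq (m≤m+n m k)

  ⊓-descent : ∀ a x c → a * x ⊓ c ≤ a * pred x ⊓ c + a
  ⊓-descent a x c = begin
    a * x ⊓ c                ≤⟨ ⊓-mono-≤ (step x) (m≤m+n c a) ⟩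
    (a * pred x + a) ⊓ (c + a)  ≡⟨ +-distribʳ-⊓ a (a * pred x) c ⟨
    a * pred x ⊓ c + a       ∎
    where
    step : ∀ x → a * x ≤ a * pred x + a
    step zero    = m≤m+n (a * zero) a
    step (suc y) = ≤-reflexive (trans (*-suc a y) (+-comm a (a * y)))

  glue-arith : ∀ {F G X Y g s m D q} → F + q ≡ X + s * q → G + (g + q) ≡ Y + s * (g + q) →
               X ≤ Y + D * g → suc D * g ≤ s * g + q * m → F ≤ G + q * m
  glue-arith {F} {G} {X} {Y} {g} {s} {m} {D} {q} old new loss gain′ = +-cancelʳ-≤ (q + (g + q)) F (G + q * m) (begin
    F + (q + (g + q))            ≡⟨ +-assoc F q (g + q) ⟨
    F + q + (g + q)              ≡⟨ cong (_+ (g + q)) old ⟩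
    X + s * q + (g + q)          ≤⟨ +-monoˡ-≤ (g + q) (+-monoˡ-≤ (s * q) loss) ⟩
    Y + D * g + s * q + (g + q)  ≡⟨ solve (Y ∷ D ∷ g ∷ s ∷ q ∷ []) ⟩
    Y + s * q + q + suc D * g    ≤⟨ +-monoʳ-≤ (Y + s * q + q) gain′ ⟩
    Y + s * q + q + (s * g + q * m)  ≡⟨ solve (Y ∷ g ∷ s ∷ q ∷ m ∷ []) ⟩
    Y + s * (g + q) + q * m + q  ≡⟨ cong (λ z → z + q * m + q) new ⟨
    G + (g + q) + q * m + q      ≡⟨ solve (G ∷ g ∷ q ∷ m ∷ []) ⟩
    G + q * m + (q + (g + q))    ∎)

  base-arith : ∀ {c g s m q} → c ≤ s * g + q * m → s * q + c ≤ s * (g + q) + q * m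
  base-arith {c} {g} {s} {m} {q} c≤ = begin
    s * q + c                   ≤⟨ +-monoʳ-≤ (s * q) c≤ ⟩
    s * q + (s * g + q * m)     ≡⟨ solve (s ∷ g ∷ q ∷ m ∷ []) ⟩
    s * (g + q) + q * m         ∎

module Weight (b : ℕ) where

  open Arithmetic
  open import Data.Nat using (ℕ; zero; suc; pred; _+_; _*_; _∸_; _⊓_; _≤_; _<_; z≤n; s≤s; s≤s⁻¹; _<ᵇ_)
  open import Data.Nat.Properties
  open import Data.Nat.Tactic.RingSolver using (solve)
  open import Data.List using (_∷_; [])
  open import Data.Sum using (inj₁; inj₂)
  open import Data.Bool using (true; false; if_then_else_)
  open import Relation.Nullary using (ofⁿ)
  open import Relation.Binary.PropositionalEquality
  open ≤-Reasoning

  weight : ℕ → ℕ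
  weight 0             = 3 + 2 * b
  weight 1             = 9 + 4 * b
  weight (suc (suc d)) = (3 + b) * (2 + b ∸ d) ⊓ (6 + 3 * b)

  gain : ℕ → ℕ
  gain D = weight D ∸ (3 + 2 * b)

  weight-2 : weight 2 ≡ 6 + 3 * b
  weight-2 = m≥n⇒m⊓n≡n (≤-offset (2 * b + b * b) (solve (b ∷ [])))

  weight-plateau : ∀ d → d < b → weight (2 + d) ≡ 6 + 3 * b
  weight-plateau d d<b = m≥n⇒m⊓n≡n (begin
    6 + 3 * b          ≤⟨ ≤-offset 3 (solve (b ∷ [])) ⟩
    (3 + b) * 3        ≤⟨ *-monoʳ-≤ (3 + b) (s≤s (s≤s (m<n⇒0<n∸m d<b))) ⟩
    (3 + b) * (2 + (b ∸ d))  ≡⟨ cong ((3 + b) *_) (+-∸-assoc 2 (<⇒≤ d<b)) ⟨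
    (3 + b) * (2 + b ∸ d)    ∎)

  weight-2+b : weight (2 + b) ≡ 6 + 2 * b
  weight-2+b = begin-equality
    (3 + b) * (2 + b ∸ b) ⊓ (6 + 3 * b)  ≡⟨ cong (λ e → (3 + b) * e ⊓ (6 + 3 * b)) (m+n∸n≡m 2 b) ⟩
    (3 + b) * 2 ⊓ (6 + 3 * b)            ≡⟨ m≤n⇒m⊓n≡m (≤-offset b (solve (b ∷ []))) ⟩
    (3 + b) * 2                          ≡⟨ solve (b ∷ []) ⟩
    6 + 2 * b                            ∎

  weight-3+b : weight (3 + b) ≡ 3 + b
  weight-3+b = begin-equality
    (3 + b) * (1 + b ∸ b) ⊓ (6 + 3 * b)  ≡⟨ cong (λ e → (3 + b) * e ⊓ (6 + 3 * b)) (m+n∸n≡m 1 b) ⟩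
    (3 + b) * 1 ⊓ (6 + 3 * b)            ≡⟨ m≤n⇒m⊓n≡m (≤-offset (3 + 2 * b) (solve (b ∷ []))) ⟩
    (3 + b) * 1                          ≡⟨ *-identityʳ (3 + b) ⟩
    3 + b                                ∎

  weight-4+b : weight (4 + b) ≡ 0
  weight-4+b = cong (_⊓ (6 + 3 * b)) (trans (cong ((3 + b) *_) (n∸n≡0 (2 + b))) (*-zeroʳ (3 + b)))

  weight-descent : ∀ d → 1 ≤ d → weight d ≤ weight (suc d) + (3 + b)
  weight-descent 1             _ = begin
    9 + 4 * b                ≡⟨ solve (b ∷ []) ⟩
    6 + 3 * b + (3 + b)      ≡⟨ cong (_+ (3 + b)) weight-2 ⟨
    weight 2 + (3 + b)       ∎
  weight-descent (suc (suc d)) _ = begin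
    (3 + b) * (2 + b ∸ d) ⊓ (6 + 3 * b)
      ≤⟨ ⊓-descent (3 + b) (2 + b ∸ d) (6 + 3 * b) ⟩
    (3 + b) * pred (2 + b ∸ d) ⊓ (6 + 3 * b) + (3 + b)
      ≡⟨ cong (λ e → (3 + b) * e ⊓ (6 + 3 * b) + (3 + b)) (pred[m∸n]≡m∸[1+n] (2 + b) d) ⟩
    weight (3 + d) + (3 + b) ∎

  weight-drop : ∀ D d → 1 ≤ d → weight d ≤ weight (D + d) + D * (3 + b)
  weight-drop zero    d _   = m≤m+n (weight d) 0
  weight-drop (suc D) d 1≤d = begin
    weight d                                    ≤⟨ weight-drop D d 1≤d ⟩
    weight (D + d) + D * (3 + b)                ≤⟨ +-monoˡ-≤ _ (weight-descent (D + d) (≤-trans 1≤d (m≤n+m d D))) ⟩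
    weight (suc D + d) + (3 + b) + D * (3 + b)  ≡⟨ +-assoc (weight (suc D + d)) (3 + b) _ ⟩
    weight (suc D + d) + suc D * (3 + b)        ∎

  weight-≥q : ∀ D → 1 ≤ D → D ≤ 2 + b → 3 + 2 * b ≤ weight D
  weight-≥q 1             _ _            = ≤-offset {n = 9 + 4 * b} (6 + 2 * b) (solve (b ∷ []))
  weight-≥q (suc (suc d)) _ (s≤s (s≤s d≤b)) = ⊓-glb (begin
    3 + 2 * b                ≤⟨ ≤-offset 3 (solve (b ∷ [])) ⟩
    (3 + b) * 2              ≤⟨ *-monoʳ-≤ (3 + b) (m≤m+n 2 (b ∸ d)) ⟩
    (3 + b) * (2 + (b ∸ d))  ≡⟨ cong ((3 + b) *_) (+-∸-assoc 2 d≤b) ⟨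
    (3 + b) * (2 + b ∸ d)    ∎) (≤-offset {n = 6 + 3 * b} (3 + b) (solve (b ∷ [])))

  gain-≥ : ∀ D x → x + (3 + 2 * b) ≤ weight D → x ≤ gain D
  gain-≥ D x = m+n≤o⇒m≤o∸n x

  gain-≤ : ∀ D x → weight D ≤ (3 + 2 * b) + x → gain D ≤ x
  gain-≤ D x = m≤n+o⇒m∸n≤o (weight D) (3 + 2 * b)

  weight≡gain+q : ∀ D → 3 + 2 * b ≤ weight D → weight D ≡ gain D + (3 + 2 * b)
  weight≡gain+q D q≤w = sym (m∸n+n≡m q≤w)

  gain-1 : 6 + 2 * b ≤ gain 1
  gain-1 = gain-≥ 1 (6 + 2 * b) (begin
    6 + 2 * b + (3 + 2 * b)  ≡⟨ solve (b ∷ []) ⟩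
    9 + 4 * b                ∎)

  gain-mid : ∀ D → 1 ≤ D → D ≤ 1 + b → 3 + b ≤ gain D
  gain-mid 1             _ _         = begin
    3 + b      ≤⟨ ≤-offset (3 + b) (solve (b ∷ [])) ⟩
    6 + 2 * b  ≤⟨ gain-1 ⟩
    gain 1     ∎
  gain-mid (suc (suc d)) _ (s≤s d<b) = gain-≥ (2 + d) (3 + b) (begin
    3 + b + (3 + 2 * b)  ≡⟨ solve (b ∷ []) ⟩
    6 + 3 * b            ≡⟨ weight-plateau d d<b ⟨
    weight (2 + d)       ∎)

  gain-top : gain (2 + b) ≡ 3
  gain-top = trans (cong (_∸ (3 + 2 * b)) weight-2+b) (m+n∸n≡m 3 (3 + 2 * b))

  gain-≤q : ∀ D → 2 ≤ D → gain D ≤ 3 + 2 * b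
  gain-≤q 1             (s≤s ())
  gain-≤q (suc (suc d)) _ = gain-≤ (2 + d) (3 + 2 * b) (begin
    weight (2 + d)           ≤⟨ m⊓n≤n _ (6 + 3 * b) ⟩
    6 + 3 * b                ≤⟨ ≤-offset b (solve (b ∷ [])) ⟩
    3 + 2 * b + (3 + 2 * b)  ∎)

  gluing-loss-top : ∀ d → 1 ≤ d → (2 + b) + d ≤ 4 + b → weight d ≤ weight ((2 + b) + d) + (2 + b) * gain (2 + b)
  gluing-loss-top d 1≤d fits = begin
    weight d
      ≤⟨ top d 1≤d (+-cancelˡ-≤ (2 + b) d 2 (subst ((2 + b) + d ≤_) (+-comm 2 (2 + b)) fits)) ⟩
    weight (d + (2 + b)) + (2 + b) * 3
      ≡⟨ cong₂ (λ x g → weight x + (2 + b) * g) (+-comm d (2 + b)) (sym gain-top) ⟩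
    weight ((2 + b) + d) + (2 + b) * gain (2 + b) ∎
    where
    top : ∀ d → 1 ≤ d → d ≤ 2 → weight d ≤ weight (d + (2 + b)) + (2 + b) * 3
    top 1 _ _ = begin
      9 + 4 * b                  ≡⟨ solve (b ∷ []) ⟩
      3 + b + (2 + b) * 3        ≡⟨ cong (_+ (2 + b) * 3) weight-3+b ⟨
      weight (3 + b) + (2 + b) * 3  ∎
    top 2 _ _ = begin
      weight 2                   ≡⟨ weight-2 ⟩
      6 + 3 * b                  ≡⟨ solve (b ∷ []) ⟩
      0 + (2 + b) * 3            ≡⟨ cong (_+ (2 + b) * 3) weight-4+b ⟨
      weight (4 + b) + (2 + b) * 3  ∎
    top (suc (suc (suc _))) _ (s≤s (s≤s ()))

  gluing-loss : ∀ D d → 1 ≤ D → D ≤ 2 + b → D + d ≤ 4 + b → weight d ≤ weight (D + d) + D * gain D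
  gluing-loss D zero 1≤D D≤2+b _ = begin
    3 + 2 * b                    ≤⟨ weight-≥q D 1≤D D≤2+b ⟩
    weight D                     ≡⟨ cong weight (+-identityʳ D) ⟨
    weight (D + 0)               ≤⟨ m≤m+n _ _ ⟩
    weight (D + 0) + D * gain D  ∎
  gluing-loss D (suc d) 1≤D D≤2+b fits with m≤n⇒m<n∨m≡n D≤2+b
  ... | inj₂ refl = gluing-loss-top (suc d) (s≤s z≤n) fits
  ... | inj₁ D<2+b = begin
    weight (suc d)                       ≤⟨ weight-drop D (suc d) (s≤s z≤n) ⟩
    weight (D + suc d) + D * (3 + b)     ≤⟨ +-monoʳ-≤ _ (*-monoʳ-≤ D (gain-mid D 1≤D (s≤s⁻¹ D<2+b))) ⟩
    weight (D + suc d) + D * gain D      ∎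

  base-gain : ∀ D → 1 ≤ D → D ≤ 2 + b → 7 + 3 * b ≤ suc D * gain D
  base-gain D 1≤D D≤2+b with m≤n⇒m<n∨m≡n D≤2+b
  ... | inj₂ refl = begin
    7 + 3 * b               ≤⟨ ≤-offset 2 (solve (b ∷ [])) ⟩
    (3 + b) * 3             ≡⟨ cong ((3 + b) *_) gain-top ⟨
    (3 + b) * gain (2 + b)  ∎
  ... | inj₁ D<2+b = below-top D 1≤D (s≤s⁻¹ D<2+b)
    where
    below-top : ∀ D → 1 ≤ D → D ≤ 1 + b → 7 + 3 * b ≤ suc D * gain D
    below-top 1 _ _ = begin
      7 + 3 * b        ≤⟨ ≤-offset (5 + b) (solve (b ∷ [])) ⟩
      2 * (6 + 2 * b)  ≤⟨ *-monoʳ-≤ 2 gain-1 ⟩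
      2 * gain 1       ∎
    below-top (suc (suc d)) _ D≤1+b = begin
      7 + 3 * b                ≤⟨ ≤-offset 2 (solve (b ∷ [])) ⟩
      3 * (3 + b)              ≤⟨ *-mono-≤ (m≤m+n 3 d) (gain-mid (2 + d) (s≤s z≤n) D≤1+b) ⟩
      (3 + d) * gain (2 + d)   ∎

  block-excess-gain : ∀ t c m → 1 ≤ c → t * c ≤ m → t * c * gain (c + t * c) ≤ (3 + 2 * b) * m
  block-excess-gain zero    c m _   _    = z≤n
  block-excess-gain (suc t) c m 1≤c tc≤m = begin
    suc t * c * gain (c + suc t * c)  ≤⟨ *-monoʳ-≤ (suc t * c) (gain-≤q (c + suc t * c) 2≤D) ⟩
    suc t * c * (3 + 2 * b)           ≡⟨ *-comm (suc t * c) (3 + 2 * b) ⟩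
    (3 + 2 * b) * (suc t * c)         ≤⟨ *-monoʳ-≤ (3 + 2 * b) tc≤m ⟩
    (3 + 2 * b) * m                   ∎
    where
    2≤D : 2 ≤ c + suc t * c
    2≤D = +-mono-≤ 1≤c (≤-trans 1≤c (m≤m+n c (t * c)))

  block-gain : ∀ {s m} t c → 1 ≤ t → 1 ≤ c → c < s → (t ∸ 1) * c ≤ m →
               suc (t * c) * gain (t * c) ≤ s * gain (t * c) + (3 + 2 * b) * m
  block-gain {s} {m} (suc t) c _ 1≤c c<s excess = begin
    suc (suc t * c) * gain (suc t * c)                   ≡⟨ *-distribʳ-+ (gain (suc t * c)) (suc c) (t * c) ⟩
    suc c * gain (suc t * c) + t * c * gain (suc t * c)  ≤⟨ +-mono-≤ (*-monoˡ-≤ _ c<s) (block-excess-gain t c m 1≤c excess) ⟩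
    s * gain (suc t * c) + (3 + 2 * b) * m               ∎

  -- The share of a vertex in p·σ_h(T) + q·(|V⁻_{k−1}| − |V_{k−1}| + |V|).
  budget : ℕ → ℕ → ℕ
  budget h d = (3 + b) * (h ∸ d) + (if h <ᵇ 4 + b then 2 * (3 + 2 * b) else 0)

  weight-≤-slack : ∀ d → weight d ≤ (3 + b) * (4 + b ∸ d)
  weight-≤-slack 0             = ≤-offset {3 + 2 * b} {(3 + b) * (4 + b)} (9 + 5 * b + b * b) (solve (b ∷ []))
  weight-≤-slack 1             = ≤-offset {9 + 4 * b} {(3 + b) * (3 + b)} (2 * b + b * b) (solve (b ∷ []))
  weight-≤-slack (suc (suc d)) = m⊓n≤m _ _

  weight-≤-reserve : ∀ {h} d → 2 ≤ h → d ≤ h → weight d ≤ (3 + b) * (h ∸ d) + 2 * (3 + 2 * b)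
  weight-≤-reserve {h} 0 _ _ = ≤-trans (m≤m+n (3 + 2 * b) (3 + 2 * b + 0)) (m≤n+m _ ((3 + b) * h))
  weight-≤-reserve {suc zero}    1 (s≤s ()) _
  weight-≤-reserve {suc (suc h)} 1 _ _ = begin
    9 + 4 * b                              ≤⟨ ≤-offset b (solve (b ∷ [])) ⟩
    (3 + b) * 1 + 2 * (3 + 2 * b)          ≤⟨ +-monoˡ-≤ _ (*-monoʳ-≤ (3 + b) (s≤s z≤n)) ⟩
    (3 + b) * suc h + 2 * (3 + 2 * b)      ∎
  weight-≤-reserve {h} (suc (suc d)) _ _ = begin
    weight (2 + d)                         ≤⟨ m⊓n≤n _ _ ⟩
    6 + 3 * b                              ≤⟨ ≤-offset b (solve (b ∷ [])) ⟩
    2 * (3 + 2 * b)                        ≤⟨ m≤n+m _ _ ⟩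
    (3 + b) * (h ∸ (2 + d)) + 2 * (3 + 2 * b)  ∎

  weight-≤-budget : ∀ {h d} → 3 ≤ h → h ≤ 4 + b → d ≤ h → weight d ≤ budget h d
  weight-≤-budget {h} {d} 3≤h h≤4+b d≤h with h <ᵇ 4 + b | <ᵇ-reflects-< h (4 + b)
  ... | true  | _        = weight-≤-reserve d (≤-trans (n≤1+n 2) 3≤h) d≤h
  ... | false | ofⁿ h≮4+b = begin
    weight d                  ≤⟨ weight-≤-slack d ⟩
    (3 + b) * (4 + b ∸ d)     ≡⟨ cong (λ x → (3 + b) * (x ∸ d)) (≤-antisym h≤4+b (≮⇒≥ h≮4+b)) ⟨
    (3 + b) * (h ∸ d)         ≡⟨ +-identityʳ _ ⟨
    (3 + b) * (h ∸ d) + 0     ∎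

  isolated-budget : ∀ {h} → 3 ≤ h → h ≤ 4 + b → (3 + 2 * b) + (7 + 3 * b) ≤ budget h 0
  isolated-budget {h} 3≤h h≤4+b with h <ᵇ 4 + b | <ᵇ-reflects-< h (4 + b)
  ... | true  | _         = begin
    3 + 2 * b + (7 + 3 * b)        ≤⟨ ≤-offset (5 + 2 * b) (solve (b ∷ [])) ⟩
    (3 + b) * 3 + 2 * (3 + 2 * b)  ≤⟨ +-monoˡ-≤ _ (*-monoʳ-≤ (3 + b) 3≤h) ⟩
    (3 + b) * h + 2 * (3 + 2 * b)  ∎
  ... | false | ofⁿ h≮4+b = begin
    3 + 2 * b + (7 + 3 * b)        ≤⟨ ≤-offset (2 + 2 * b + b * b) (solve (b ∷ [])) ⟩
    (3 + b) * (4 + b) + 0          ≡⟨ cong (λ x → (3 + b) * x + 0) (≤-antisym h≤4+b (≮⇒≥ h≮4+b)) ⟨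
    (3 + b) * h + 0                ∎

  block-base : ∀ {s m} D → 1 ≤ D → D ≤ 2 + b → suc D * gain D ≤ s * gain D + (3 + 2 * b) * m →
               s * (3 + 2 * b) + (7 + 3 * b) ≤ s * weight D + (3 + 2 * b) * m
  block-base {s} {m} D 1≤D D≤2+b block =
    subst (λ w → s * (3 + 2 * b) + (7 + 3 * b) ≤ s * w + (3 + 2 * b) * m) (sym (weight≡gain+q D (weight-≥q D 1≤D D≤2+b)))
          (base-arith {7 + 3 * b} {gain D} {s} {m} {3 + 2 * b} (≤-trans (base-gain D 1≤D D≤2+b) block))

  block-glue : ∀ {s m F G} D d₀ → 1 ≤ D → D ≤ 2 + b → D + d₀ ≤ 4 + b →
               suc D * gain D ≤ s * gain D + (3 + 2 * b) * m →
               F + (3 + 2 * b) ≡ weight d₀ + s * (3 + 2 * b) → G + weight D ≡ weight (D + d₀) + s * weight D →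
               F ≤ G + (3 + 2 * b) * m
  block-glue {s} {m} {F} {G} D d₀ 1≤D D≤2+b fits block old new =
    glue-arith {F} {G} {weight d₀} {weight (D + d₀)} {gain D} {s} {m} {D} {3 + 2 * b} old
               (subst (λ w → G + w ≡ weight (D + d₀) + s * w) (weight≡gain+q D (weight-≥q D 1≤D D≤2+b)) new)
               (gluing-loss D d₀ 1≤D D≤2+b fits) block

module Invariant (b : ℕ) where

  open FiniteSums
  open Shapes
  open Blocks
  open Weight b
  open import Data.Nat using (ℕ; suc; _+_; _*_; _∸_; _≤_; s≤s⁻¹; _<ᵇ_)
  open import Data.Nat.Properties
    using (+-identityʳ; *-identityʳ; +-assoc; +-comm; *-comm; *-distribˡ-+; +-monoˡ-≤; +-monoʳ-≤; *-monoʳ-≤;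
           m≤m+n; m+n≤o⇒n≤o; ≤-trans; ≤∧≢⇒<; module ≤-Reasoning)
  open import Data.Fin using (Fin; zero; fromℕ<)
  open import Data.List using (List; []; _∷_)
  open import Data.List.Relation.Unary.All using (All; []; _∷_; tabulate)
  open import Data.List.Membership.Propositional using (_∈_)
  open import Data.Product using (_×_; _,_; proj₁; proj₂)
  open import Data.Sum using (inj₁; inj₂)
  open import Data.Bool using (if_then_else_)
  open import Function using (_∘_)
  open import Relation.Nullary using (¬_)
  open import Relation.Binary.PropositionalEquality
  open ≤-Reasoning

  module _ {n : ℕ} where

    potential : List (Block n) → ℕ
    potential bs = sumFin (λ v → weight (degL bs v)) + (3 + 2 * b) * mL bs

    block-inequality : (B : Block n) →
      suc (blockDegree B) * gain (blockDegree B) ≤ size B * gain (blockDegree B) + (3 + 2 * b) * mB B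
    block-inequality B = block-gain (mul B) (skeletonDegreeB B) (mul-pos B)
      (skeletonDegree-pos (shape B) (size-ok B)) (skeletonDegree-< (shape B) (size-ok B)) (mB-≥ B)

    potential-single : ∀ B → blockDegree B ≤ 2 + b → (3 + 2 * b) * n + (7 + 3 * b) ≤ potential (B ∷ [])
    potential-single B D≤2+b = begin
      (3 + 2 * b) * n + (7 + 3 * b)
        ≡⟨ cong (_+ (7 + 3 * b)) (trans (*-comm (3 + 2 * b) n) (sym (sumFin-const {n} (3 + 2 * b)))) ⟩
      sumFin {n} (λ _ → 3 + 2 * b) + (7 + 3 * b)
        ≤⟨ sumFin-≤-from-image (vert B) (vert-inj B) (λ _ → 3 + 2 * b) (λ v → weight (degL (B ∷ []) v)) outside
                               (7 + 3 * b) ((3 + 2 * b) * mL (B ∷ [])) on-block ⟩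
      potential (B ∷ []) ∎
      where
      outside : ∀ u → (∀ i → vert B i ≢ u) → 3 + 2 * b ≡ weight (degB B u + 0)
      outside u u∉B = cong weight (sym (trans (+-identityʳ (degB B u)) (degB-out B u∉B)))
      on-block : sumFin {size B} (λ _ → 3 + 2 * b) + (7 + 3 * b) ≤
                 sumFin (λ i → weight (degB B (vert B i) + 0)) + (3 + 2 * b) * (mB B + 0)
      on-block = begin
        sumFin {size B} (λ _ → 3 + 2 * b) + (7 + 3 * b)
          ≡⟨ cong (_+ (7 + 3 * b)) (sumFin-const {size B} (3 + 2 * b)) ⟩
        size B * (3 + 2 * b) + (7 + 3 * b)
          ≤⟨ block-base {size B} {mB B} (blockDegree B) (blockDegree-pos B) D≤2+b (block-inequality B) ⟩
        size B * weight (blockDegree B) + (3 + 2 * b) * mB B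
          ≡⟨ cong₂ (λ x y → x + (3 + 2 * b) * y) (sym (sumFin-const {size B} (weight (blockDegree B))))
                                                   (sym (+-identityʳ (mB B))) ⟩
        sumFin {size B} (λ _ → weight (blockDegree B)) + (3 + 2 * b) * (mB B + 0)
          ≡⟨ cong (_+ (3 + 2 * b) * (mB B + 0)) (sumFin-cong (λ i → cong weight (trans (+-identityʳ _) (degB-vert B i)))) ⟨
        sumFin (λ i → weight (degB B (vert B i) + 0)) + (3 + 2 * b) * (mB B + 0) ∎

    potential-glue : ∀ B bs → SharesExactlyOne B bs → blockDegree B ≤ 2 + b → (∀ v → degL (B ∷ bs) v ≤ 4 + b) →
                     potential bs ≤ potential (B ∷ bs)
    potential-glue B bs (v₀ , ((i₀ , i₀↦v₀) , _) , unique) D≤2+b bounded = begin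
      sumFin (λ v → weight (degL bs v)) + (3 + 2 * b) * mL bs
        ≤⟨ +-monoˡ-≤ _ glued ⟩
      sumFin (λ v → weight (degL (B ∷ bs) v)) + (3 + 2 * b) * mB B + (3 + 2 * b) * mL bs
        ≡⟨ +-assoc (sumFin (λ v → weight (degL (B ∷ bs) v))) _ _ ⟩
      sumFin (λ v → weight (degL (B ∷ bs) v)) + ((3 + 2 * b) * mB B + (3 + 2 * b) * mL bs)
        ≡⟨ cong (sumFin (λ v → weight (degL (B ∷ bs) v)) +_) (*-distribˡ-+ (3 + 2 * b) (mB B) (mL bs)) ⟨
      potential (B ∷ bs) ∎
      where
      D d₀ : ℕ
      D  = blockDegree B
      d₀ = degL bs (vert B i₀)
      outside-bs : ∀ i → i ≢ i₀ → ¬ InSome bs (vert B i)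
      outside-bs i i≢i₀ in-bs = i≢i₀ (vert-inj B (trans (unique (vert B i) (i , refl) in-bs) (sym i₀↦v₀)))
      old : sumFin (λ i → weight (degL bs (vert B i))) + (3 + 2 * b) ≡ weight d₀ + size B * (3 + 2 * b)
      old = sumFin-all-but-one (λ i → weight (degL bs (vert B i))) i₀ (3 + 2 * b)
              (λ i i≢i₀ → cong weight (degL-out bs (outside-bs i i≢i₀)))
      new : sumFin (λ i → weight (degL (B ∷ bs) (vert B i))) + weight D ≡ weight (D + d₀) + size B * weight D
      new = trans (sumFin-all-but-one (λ i → weight (degL (B ∷ bs) (vert B i))) i₀ (weight D)
                    (λ i i≢i₀ → cong weight (trans (cong₂ _+_ (degB-vert B i) (degL-out bs (outside-bs i i≢i₀)))
                                                   (+-identityʳ D))))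
                  (cong (λ x → weight (x + d₀) + size B * weight D) (degB-vert B i₀))
      fits : D + d₀ ≤ 4 + b
      fits = subst (_≤ 4 + b) (cong (_+ d₀) (degB-vert B i₀)) (bounded (vert B i₀))
      outside-B : ∀ u → (∀ i → vert B i ≢ u) → weight (degL bs u) ≡ weight (degL (B ∷ bs) u)
      outside-B u u∉B = cong (λ x → weight (x + degL bs u)) (sym (degB-out B u∉B))
      glued : sumFin (λ v → weight (degL bs v)) ≤ sumFin (λ v → weight (degL (B ∷ bs) v)) + (3 + 2 * b) * mB B
      glued = subst (_≤ sumFin (λ v → weight (degL (B ∷ bs) v)) + (3 + 2 * b) * mB B) (+-identityʳ _)
        (sumFin-≤-from-image (vert B) (vert-inj B) (λ v → weight (degL bs v)) (λ v → weight (degL (B ∷ bs) v)) outside-B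
                             0 ((3 + 2 * b) * mB B)
                             (subst (_≤ sumFin (λ i → weight (degL (B ∷ bs) (vert B i))) + (3 + 2 * b) * mB B)
                                    (sym (+-identityʳ _))
                                    (block-glue {size B} {mB B} D d₀ (blockDegree-pos B) D≤2+b fits
                                                (block-inequality B) old new)))

    potential-bound : ∀ {bs} → Attached bs → (∀ v → degL bs v ≤ 4 + b) → All (λ B → blockDegree B ≤ 2 + b) bs →
                      (3 + 2 * b) * n + (7 + 3 * b) ≤ potential bs
    potential-bound (one B)            _       (D≤2+b ∷ []) = potential-single B D≤2+b
    potential-bound (add B att shares) bounded (D≤2+b ∷ small) =
      ≤-trans (potential-bound att (λ v → m+n≤o⇒n≤o (degB B v) (bounded v)) small)
              (potential-glue B _ shares D≤2+b bounded)

  small-blocks : ∀ {n} (T : GDPTree n) (h : Fin n → ℕ) → (∀ v → h v ≤ 4 + b) → (∀ v → deg T v ≤ h v) →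
                 (∀ B → B ∈ blocks T → ¬ IsRegular B (4 + b) × ¬ IsRegular B (3 + b)) →
                 All (λ B → blockDegree B ≤ 2 + b) (blocks T)
  small-blocks T h h≤4+b deg≤h irregular = tabulate small
    where
    small : ∀ {B} → B ∈ blocks T → blockDegree B ≤ 2 + b
    small {B} B∈T = s≤s⁻¹ (≤∧≢⇒< (s≤s⁻¹ (≤∧≢⇒< D≤4+b (regular (proj₁ (irregular B B∈T)))))
                                (regular (proj₂ (irregular B B∈T))))
      where
      i : Fin (size B)
      i = fromℕ< (size-≥2 B)
      D≤4+b : blockDegree B ≤ 4 + b
      D≤4+b = begin
        blockDegree B           ≡⟨ degB-vert B i ⟨
        degB B (vert B i)       ≤⟨ degB≤degL B∈T (vert B i) ⟩
        degL (blocks T) (vert B i)  ≡⟨ deg≡degL T (vert B i) ⟨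
        deg T (vert B i)        ≤⟨ deg≤h (vert B i) ⟩
        h (vert B i)            ≤⟨ h≤4+b (vert B i) ⟩
        4 + b                   ∎
      regular : ∀ {d} → ¬ IsRegular B d → blockDegree B ≢ d
      regular ¬regular refl = ¬regular (degB-vert B)

  tree-potential : ∀ {n} (T : GDPTree n) (h : Fin n → ℕ) → (∀ v → 3 ≤ h v × h v ≤ 4 + b) → (∀ v → deg T v ≤ h v) →
                   (∀ B → B ∈ blocks T → ¬ IsRegular B (4 + b) × ¬ IsRegular B (3 + b)) →
                   (3 + 2 * b) * n + (7 + 3 * b) ≤ sumFin (λ v → budget (h v) (deg T v)) + (3 + 2 * b) * mL (blocks T)
  tree-potential {n} T h h-range deg≤h irregular with structure T
  ... | inj₁ (refl , no-blocks) = begin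
    (3 + 2 * b) * 1 + (7 + 3 * b)            ≡⟨ cong (_+ (7 + 3 * b)) (*-identityʳ (3 + 2 * b)) ⟩
    3 + 2 * b + (7 + 3 * b)                  ≤⟨ isolated-budget (proj₁ (h-range zero)) (proj₂ (h-range zero)) ⟩
    budget (h zero) 0                        ≡⟨ cong (budget (h zero)) isolated ⟨
    budget (h zero) (deg T zero)             ≤⟨ ≤-trans (m≤m+n _ 0) (m≤m+n _ _) ⟩
    sumFin (λ v → budget (h v) (deg T v)) + (3 + 2 * b) * mL (blocks T) ∎
    where
    isolated : deg T zero ≡ 0
    isolated = trans (deg≡degL T zero) (cong (λ bs → degL bs zero) no-blocks)
  ... | inj₂ (attached , _) = begin
    (3 + 2 * b) * n + (7 + 3 * b)
      ≤⟨ potential-bound attached bounded (small-blocks T h (proj₂ ∘ h-range) deg≤h irregular) ⟩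
    sumFin (λ v → weight (degL (blocks T) v)) + (3 + 2 * b) * mL (blocks T)
      ≤⟨ +-monoˡ-≤ _ (sumFin-mono within-budget) ⟩
    sumFin (λ v → budget (h v) (deg T v)) + (3 + 2 * b) * mL (blocks T) ∎
    where
    bounded : ∀ v → degL (blocks T) v ≤ 4 + b
    bounded v = subst (_≤ 4 + b) (deg≡degL T v) (≤-trans (deg≤h v) (proj₂ (h-range v)))
    within-budget : ∀ v → weight (degL (blocks T) v) ≤ budget (h v) (deg T v)
    within-budget v = subst (λ d → weight d ≤ budget (h v) (deg T v)) (deg≡degL T v)
                            (weight-≤-budget (proj₁ (h-range v)) (proj₂ (h-range v)) (deg≤h v))

  sumFin-budget : ∀ {n} (h d : Fin n → ℕ) → sumFin (λ v → budget (h v) (d v)) ≡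
                  (3 + b) * sumFin (λ v → h v ∸ d v) + 2 * (3 + 2 * b) * countFin (λ v → h v <ᵇ 4 + b)
  sumFin-budget h d = begin-equality
    sumFin (λ v → budget (h v) (d v))
      ≡⟨ sumFin-+ (λ v → (3 + b) * (h v ∸ d v)) (λ v → if h v <ᵇ 4 + b then 2 * (3 + 2 * b) else 0) ⟩
    sumFin (λ v → (3 + b) * (h v ∸ d v)) + sumFin (λ v → if h v <ᵇ 4 + b then 2 * (3 + 2 * b) else 0)
      ≡⟨ cong₂ _+_ (sumFin-*ˡ (3 + b) (λ v → h v ∸ d v))
                   (trans (sumFin-cong (λ v → if-as-* (h v <ᵇ 4 + b) (2 * (3 + 2 * b))))
                          (sumFin-*ˡ (2 * (3 + 2 * b)) (λ v → if h v <ᵇ 4 + b then 1 else 0))) ⟩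
    (3 + b) * sumFin (λ v → h v ∸ d v) + 2 * (3 + 2 * b) * countFin (λ v → h v <ᵇ 4 + b) ∎

  tree-bound : ∀ {n} (T : GDPTree n) (h : Fin n → ℕ) → (∀ v → 3 ≤ h v × h v ≤ 4 + b) → (∀ v → deg T v ≤ h v) →
               (∀ B → B ∈ blocks T → ¬ IsRegular B (4 + b) × ¬ IsRegular B (3 + b)) →
               (3 + 2 * b) * n + (7 + 3 * b) + (3 + 2 * b) * numSkelEdges T ≤
               (3 + b) * sumFin (λ v → h v ∸ deg T v) + 2 * (3 + 2 * b) * countFin (λ v → h v <ᵇ 4 + b)
                 + (3 + 2 * b) * numEdges T
  tree-bound {n} T h h-range deg≤h irregular = begin
    (3 + 2 * b) * n + (7 + 3 * b) + q * numSkelEdges T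
      ≤⟨ +-monoˡ-≤ _ (tree-potential T h h-range deg≤h irregular) ⟩
    Σbudget + q * mL (blocks T) + q * numSkelEdges T
      ≡⟨ +-assoc Σbudget _ _ ⟩
    Σbudget + (q * mL (blocks T) + q * numSkelEdges T)
      ≡⟨ cong (Σbudget +_) (trans (cong (q *_) (+-comm (numSkelEdges T) (mL (blocks T))))
                                  (*-distribˡ-+ q (mL (blocks T)) (numSkelEdges T))) ⟨
    Σbudget + q * (numSkelEdges T + mL (blocks T))
      ≤⟨ +-monoʳ-≤ Σbudget (*-monoʳ-≤ q (numSkelEdges+mL≤numEdges T)) ⟩
    Σbudget + q * numEdges T
      ≡⟨ cong (_+ q * numEdges T) (sumFin-budget h (deg T)) ⟩
    (3 + b) * sumFin (λ v → h v ∸ deg T v) + 2 * q * countFin (λ v → h v <ᵇ 4 + b) + q * numEdges T ∎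
    where
    q Σbudget : ℕ
    q = 3 + 2 * b
    Σbudget = sumFin (λ v → budget (h v) (deg T v))

module IntegerBound where

  open import Data.Nat as ℕ using (ℕ; zero; suc; _∸_)
  import Data.Nat.Properties as ℕ
  open import Data.Nat.Tactic.RingSolver using (solve)
  open import Data.Integer using (ℤ; +_; _+_; _-_; _*_; _≤_; +≤+)
  open import Data.Integer.Properties using (pos-+; pos-*; m-n≡m⊖n; ⊖-≥)
  import Data.Integer.Tactic.RingSolver as ℤ-Solver
  open import Data.Fin using (Fin; zero; suc)
  open import Data.List using (_∷_; [])
  open import Function using (_∘_)
  open import Relation.Binary.PropositionalEquality

  sumFinℤ-cong : ∀ {n} {f g : Fin n → ℤ} → (∀ i → f i ≡ g i) → sumFinℤ f ≡ sumFinℤ g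
  sumFinℤ-cong {zero}  eq = refl
  sumFinℤ-cong {suc n} eq = cong₂ _+_ (eq zero) (sumFinℤ-cong (eq ∘ suc))

  sumFinℤ-pos : ∀ {n} (f : Fin n → ℕ) → sumFinℤ (λ v → + f v) ≡ + sumFin f
  sumFinℤ-pos {zero}  f = refl
  sumFinℤ-pos {suc n} f = trans (cong (_+_ (+ f zero)) (sumFinℤ-pos (f ∘ suc))) (sym (pos-+ (f zero) _))

  pos-∸ : ∀ {m n} → n ℕ.≤ m → + m - + n ≡ + (m ∸ n)
  pos-∸ {m} {n} n≤m = trans (m-n≡m⊖n m n) (⊖-≥ n≤m)

  sigma≡ : ∀ {n} (T : GDPTree n) h → (∀ v → deg T v ℕ.≤ h v) → sigma T h ≡ + sumFin (λ v → h v ∸ deg T v)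
  sigma≡ T h deg≤h = trans (sumFinℤ-cong (λ v → pos-∸ (deg≤h v))) (sumFinℤ-pos (λ v → h v ∸ deg T v))

  regroup : ∀ (p σ q E S V W : ℤ) → p * σ + q * (E + V) - q * (S + W) ≡ p * σ + q * (E - S + V - W)
  regroup = ℤ-Solver.solve-∀

  ℤ-bound : ∀ {n} c p q σ E S V W → n ≡ V ℕ.+ W →
            q ℕ.* n ℕ.+ c ℕ.+ q ℕ.* S ℕ.≤ p ℕ.* σ ℕ.+ 2 ℕ.* q ℕ.* V ℕ.+ q ℕ.* E →
            + c ≤ + p * + σ + + q * (+ E - + S + + V - + W)
  ℤ-bound c p q σ E S V W refl le =
    subst (+ c ≤_) (trans (sym (pos-∸ minus≤plus)) cast) (+≤+ (ℕ.m+n≤o⇒m≤o∸n c c+minus≤plus))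
    where
    plus minus : ℕ
    plus = p ℕ.* σ ℕ.+ q ℕ.* (E ℕ.+ V)
    minus = q ℕ.* (S ℕ.+ W)
    c+minus≤plus : c ℕ.+ minus ℕ.≤ plus
    c+minus≤plus = ℕ.+-cancelʳ-≤ (q ℕ.* V) (c ℕ.+ minus) plus (begin
      c ℕ.+ q ℕ.* (S ℕ.+ W) ℕ.+ q ℕ.* V          ≡⟨ solve (c ∷ q ∷ S ∷ W ∷ V ∷ []) ⟩
      q ℕ.* (V ℕ.+ W) ℕ.+ c ℕ.+ q ℕ.* S          ≤⟨ le ⟩
      p ℕ.* σ ℕ.+ 2 ℕ.* q ℕ.* V ℕ.+ q ℕ.* E      ≡⟨ solve (p ∷ σ ∷ q ∷ V ∷ E ∷ []) ⟩
      p ℕ.* σ ℕ.+ q ℕ.* (E ℕ.+ V) ℕ.+ q ℕ.* V    ∎)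
      where open ℕ.≤-Reasoning
    minus≤plus : minus ℕ.≤ plus
    minus≤plus = ℕ.m+n≤o⇒n≤o c c+minus≤plus
    cast : + plus - + minus ≡ + p * + σ + + q * (+ E - + S + + V - + W)
    cast = begin
      + plus - + minus
        ≡⟨ cong₂ _-_ (trans (pos-+ (p ℕ.* σ) _) (cong₂ _+_ (pos-* p σ) (trans (pos-* q _) (cong (+ q *_) (pos-+ E V)))))
                     (trans (pos-* q _) (cong (+ q *_) (pos-+ S W))) ⟩
      + p * + σ + + q * (+ E + + V) - + q * (+ S + + W)
        ≡⟨ regroup (+ p) (+ σ) (+ q) (+ E) (+ S) (+ V) (+ W) ⟩
      + p * + σ + + q * (+ E - + S + + V - + W) ∎
      where open ≡-Reasoning

module RationalBound where

  open import Data.Nat as ℕ using (ℕ; suc)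
  import Data.Nat.Properties as ℕ
  open import Data.Integer as ℤ using (ℤ; +_)
  import Data.Integer.Properties as ℤ
  open import Data.Rational as ℚ using (ℚ; 1ℚ)
  import Data.Rational.Properties as ℚ
  open import Data.Rational.Unnormalised as ℚᵘ using (ℚᵘ; mkℚᵘ; *<*)
  import Data.Rational.Unnormalised.Properties as ℚᵘ
  open import Relation.Binary.PropositionalEquality

  -- Both sides have denominator q as unnormalised rationals, so the comparison reduces to their numerators.
  ℚ-bound : ∀ p q′ (σ M : ℤ) → + (p ℕ.+ suc q′) ℤ.< + p ℤ.* σ ℤ.+ + suc q′ ℤ.* M →
            1ℚ ℚ.+ (+ p ℚ./ suc q′) ℚ.< (+ p ℚ./ suc q′) ℚ.* (σ ℚ./ 1) ℚ.+ (M ℚ./ 1)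
  ℚ-bound p q′ σ M lt =
    ℚ.toℚᵘ-cancel-< (ℚᵘ.<-respʳ-≃ (ℚᵘ.≃-sym rhs) (ℚᵘ.<-respˡ-≃ (ℚᵘ.≃-sym lhs) unnormalised))
    where
    α : ℚᵘ
    α = mkℚᵘ (+ p) q′
    lhs : ℚ.toℚᵘ (1ℚ ℚ.+ (+ p ℚ./ suc q′)) ℚᵘ.≃ ℚᵘ.1ℚᵘ ℚᵘ.+ α
    lhs = ℚᵘ.≃-trans (ℚ.toℚᵘ-homo-+ 1ℚ (+ p ℚ./ suc q′)) (ℚᵘ.+-cong ℚᵘ.≃-refl (ℚ.toℚᵘ-fromℚᵘ α))
    rhs : ℚ.toℚᵘ ((+ p ℚ./ suc q′) ℚ.* (σ ℚ./ 1) ℚ.+ (M ℚ./ 1)) ℚᵘ.≃ α ℚᵘ.* mkℚᵘ σ 0 ℚᵘ.+ mkℚᵘ M 0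
    rhs = ℚᵘ.≃-trans (ℚ.toℚᵘ-homo-+ ((+ p ℚ./ suc q′) ℚ.* (σ ℚ./ 1)) (M ℚ./ 1))
            (ℚᵘ.+-cong (ℚᵘ.≃-trans (ℚ.toℚᵘ-homo-* (+ p ℚ./ suc q′) (σ ℚ./ 1))
                                   (ℚᵘ.*-cong (ℚ.toℚᵘ-fromℚᵘ α) (ℚ.toℚᵘ-fromℚᵘ (mkℚᵘ σ 0))))
                       (ℚ.toℚᵘ-fromℚᵘ (mkℚᵘ M 0)))
    unnormalised : ℚᵘ.1ℚᵘ ℚᵘ.+ α ℚᵘ.< α ℚᵘ.* mkℚᵘ σ 0 ℚᵘ.+ mkℚᵘ M 0
    unnormalised = *<* (subst₂ ℤ._<_ (cong₂ ℤ._*_ (sym numˡ) (sym denʳ)) (cong₂ ℤ._*_ (sym numʳ) (sym denˡ))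
                              (ℤ.*-monoʳ-<-pos (+ suc q′) lt))
      where
      numˡ : ℚᵘ.↥ (ℚᵘ.1ℚᵘ ℚᵘ.+ α) ≡ + (p ℕ.+ suc q′)
      numˡ = trans (cong₂ ℤ._+_ (ℤ.*-identityˡ (+ suc q′)) (ℤ.*-identityʳ (+ p)))
                   (trans (sym (ℤ.pos-+ (suc q′) p)) (cong +_ (ℕ.+-comm (suc q′) p)))
      denˡ : ℚᵘ.↧ (ℚᵘ.1ℚᵘ ℚᵘ.+ α) ≡ + suc q′
      denˡ = cong +_ (ℕ.*-identityˡ (suc q′))
      numʳ : ℚᵘ.↥ (α ℚᵘ.* mkℚᵘ σ 0 ℚᵘ.+ mkℚᵘ M 0) ≡ + p ℤ.* σ ℤ.+ + suc q′ ℤ.* M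
      numʳ = cong₂ ℤ._+_ (ℤ.*-identityʳ (+ p ℤ.* σ))
                         (trans (cong (M ℤ.*_) (cong +_ (ℕ.*-identityʳ (suc q′)))) (ℤ.*-comm M (+ suc q′)))
      denʳ : ℚᵘ.↧ (α ℚᵘ.* mkℚᵘ σ 0 ℚᵘ.+ mkℚᵘ M 0) ≡ + suc q′
      denʳ = cong +_ (trans (ℕ.*-identityʳ _) (ℕ.*-identityʳ (suc q′)))

open import Data.Nat using (_≤_; _∸_)
open import Data.Fin using (Fin)
open import Data.Product using (_×_; proj₂)
open import Data.List.Membership.Propositional using (_∈_)
open import Relation.Nullary using (¬_)
open import Data.Rational using (1ℚ; _+_; _<_)
import Data.Nat as ℕ
import Data.Nat.Properties as ℕ
import Data.Integer as ℤ
import Data.Integer.Properties as ℤ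
open import Data.Nat.Tactic.RingSolver using (solve)
open import Data.List using (_∷_; [])
open import Function using (_∘_)
open import Relation.Binary.PropositionalEquality using (_≡_; sym)
open FiniteSums using (countFin-below+at)
open Invariant using (tree-bound)
open IntegerBound using (sigma≡; ℤ-bound)
open RationalBound using (ℚ-bound)

lemma3p2 : (k : ℕ) → 5 ≤ k → {n : ℕ} (T : GDPTree n) (h : Fin n → ℕ)
    → (∀ v → 3 ≤ h v × h v ≤ k ∸ 1)
    → (∀ v → deg T v ≤ h v)
    → (∀ B → B ∈ blocks T → ¬ IsRegular B (k ∸ 1) × ¬ IsRegular B (k ∸ 2))
    → 1ℚ + alpha k < Phi k T h
lemma3p2 _ (ℕ.s≤s (ℕ.s≤s (ℕ.s≤s (ℕ.s≤s (ℕ.s≤s {n = b} _))))) {n} T h h-range deg≤h irregular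
  rewrite sigma≡ T h deg≤h =
  ℚ-bound (3 ℕ.+ b) (2 ℕ.+ 2 ℕ.* b) (ℤ.+ σ′) (mT T ℤ.+ ℤ.+ Vm ℤ.- ℤ.+ Vq)
          (ℤ.<-≤-trans (ℤ.+<+ p+q<7+3b)
                       (ℤ-bound (7 ℕ.+ 3 ℕ.* b) (3 ℕ.+ b) (3 ℕ.+ 2 ℕ.* b) σ′ (numEdges T) (numSkelEdges T) Vm Vq
                                (sym counts) (tree-bound b T h h-range deg≤h irregular)))
  where
  p+q<7+3b : 3 ℕ.+ b ℕ.+ ℕ.suc (2 ℕ.+ 2 ℕ.* b) ℕ.< 7 ℕ.+ 3 ℕ.* b
  p+q<7+3b = ℕ.≤-reflexive (solve (b ∷ []))
  σ′ Vm Vq : ℕ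
  σ′ = sumFin (λ v → h v ∸ deg T v)
  Vm = countFin (λ v → h v ℕ.<ᵇ 4 ℕ.+ b)
  Vq = countFin (λ v → h v ℕ.≡ᵇ 4 ℕ.+ b)
  counts : Vm ℕ.+ Vq ≡ n
  counts = countFin-below+at h (4 ℕ.+ b) (proj₂ ∘ h-range)
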